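{- For every $n\in\mathbb{N}$, \[ \sum_{k=1}^{n}\frac{(-1)^{k-1}}{k^2}\binom{n}{k}\left\{H_{n-k}^2+H_{n-k}^{(2)}\right\}=\frac{\left(H_n^2+H_n^{(2)}\right)^2}{2}-2\sum_{k=0}^{n-1}\frac{(-1)^k(H_n-H_k)^2}{(k+1)(n-k)\binom{n}{k}}. \]
   Context: For $m\in\mathbb{N}_0$, $H_m^{(r)}=\sum_{j=1}^{m}\frac{1}{j^r}$ (with $H_0^{(r)}=0$) and $H_m=H_m^{(1)}$. -}

module Defs where

open import Data.Nat as ℕ using (ℕ; zero; suc)
open import Data.Integer as ℤ using (ℤ)
open import Data.Rational using (ℚ; 0ℚ; 1ℚ; _+_; _*_; _/_; -_)

sumFrom1 : ℕ → (ℕ → ℚ) → ℚ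
sumFrom1 zero    f = 0ℚ
sumFrom1 (suc n) f = sumFrom1 n f + f (suc n)

sumBelow : ℕ → (ℕ → ℚ) → ℚ
sumBelow zero    f = 0ℚ
sumBelow (suc n) f = sumBelow n f + f n

ℕtoℚ : ℕ → ℚ
ℕtoℚ m = ℤ.+ m / 1

-- 1/d for a natural number d  (convention: value 0 at d = 0; only ever
-- applied to nonzero d in the statement)
invℕ : ℕ → ℚ
invℕ zero    = 0ℚ
invℕ (suc m) = ℤ.+ 1 / suc m

signQ : ℕ → ℚ
signQ zero    = 1ℚ
signQ (suc m) = - signQ m

H^ : ℕ → ℕ → ℚ
H^ r m = sumFrom1 m (λ j → invℕ (j ℕ.^ r))

H : ℕ → ℚ
H m = H^ 1 m

-- Put u_n(x) = ∏_{j ≤ n} j / (j + x) = 1 - H_n x + ½ (H_n² + H_n^{(2)}) x² + O(x³), and more generally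
-- Q_k(n, x) = ∏_{k < j ≤ n} j / (j + x). In ℚ[x,y]/(x³,y³), where m + x, m + y and m + x + y are invertible
-- for m ≥ 1, consider
--   N_n = Σ_k C(n,k) β_k(y) u_{n-k}(x)   with β_0 = 1 and β_k(y) = (-1)^k y / (k + y),
--   R_n = u_n(x) u_n(y) - x y Σ_{k<n} w(n,k) Q_k(n,x) Q_k(n,y)   with w(n,k) = (-1)^k / ((k+1)(n-k) C(n,k)).
-- Both start at 1 and satisfy (n+1+x+y) F_{n+1} = (n+1) F_n + x β_{n+1}(y) + y β_{n+1}(x): for N_n this
-- follows from Pascal's rule and Σ_k C(n,k) (-1)^k u_{n-k}(x) = β_n(x) (n ≥ 1), for R_n from a telescoping sum.
-- So N_n = R_n, and the identity is twice the comparison of their coefficients of x²y².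

module Submission where

open import Defs
open import Algebra
open import Algebra.Structures
open import Algebra.Morphism.Structures using (IsRingHomomorphism)
open import Algebra.Morphism.Construct.Composition using (isRingHomomorphism)
import Algebra.Properties.Ring as RingProperties
import Algebra.Solver.Ring
import Algebra.Solver.Ring.NaturalCoefficients.Default as NatSolver
import Algebra.Solver.Ring.AlmostCommutativeRing as ACR
open import Data.Maybe using (Maybe; just; nothing)
open import Data.Nat as ℕ using (ℕ; zero; suc; _∸_)
import Data.Nat.Properties as ℕ
open import Data.Nat.Combinatorics using (_C_)
open import Data.Product using (_,_)
open import Data.Rational as ℚ using (ℚ; 0ℚ; 1ℚ)
import Data.Rational.Properties as ℚ
open import Level using (_⊔_)
open import Relation.Nullary using (yes; no)
import Relation.Binary.PropositionalEquality as ≡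

module Arithmetic where
  open import Data.Integer as ℤ using (+_)
  import Data.Integer.Properties as ℤ
  open import Data.Rational using (ℚ; 0ℚ; 1ℚ; _+_; _*_; fromℚᵘ)
  open import Data.Rational.Properties
  open import Data.Rational.Unnormalised as ℚᵘ using (mkℚᵘ; *≡*)
  import Data.Rational.Unnormalised.Properties as ℚᵘ
  open import Relation.Binary.PropositionalEquality
  open import Tactic.RingSolver using (solve-∀)
  open import Tactic.RingSolver.Core.AlmostCommutativeRing using (AlmostCommutativeRing; fromCommutativeRing)

  fromℚᵘ-+ : ∀ p q → fromℚᵘ (p ℚᵘ.+ q) ≡ fromℚᵘ p + fromℚᵘ q
  fromℚᵘ-+ p q = toℚᵘ-injective (ℚᵘ.≃-trans (toℚᵘ-fromℚᵘ (p ℚᵘ.+ q))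
    (ℚᵘ.≃-sym (ℚᵘ.≃-trans (toℚᵘ-homo-+ (fromℚᵘ p) (fromℚᵘ q))
      (ℚᵘ.+-cong (toℚᵘ-fromℚᵘ p) (toℚᵘ-fromℚᵘ q)))))

  fromℚᵘ-* : ∀ p q → fromℚᵘ (p ℚᵘ.* q) ≡ fromℚᵘ p * fromℚᵘ q
  fromℚᵘ-* p q = toℚᵘ-injective (ℚᵘ.≃-trans (toℚᵘ-fromℚᵘ (p ℚᵘ.* q))
    (ℚᵘ.≃-sym (ℚᵘ.≃-trans (toℚᵘ-homo-* (fromℚᵘ p) (fromℚᵘ q))
      (ℚᵘ.*-cong (toℚᵘ-fromℚᵘ p) (toℚᵘ-fromℚᵘ q)))))

  -- ℕtoℚ m and invℕ (suc m) are, by definition, fromℚᵘ of the unnormalised fractions m/1 and 1/(m+1).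
  ℕtoℚ-+ : ∀ m n → ℕtoℚ (m ℕ.+ n) ≡ ℕtoℚ m + ℕtoℚ n
  ℕtoℚ-+ m n = trans (fromℚᵘ-cong {mkℚᵘ (+ (m ℕ.+ n)) 0} {mkℚᵘ (+ m) 0 ℚᵘ.+ mkℚᵘ (+ n) 0} (*≡* eq))
                     (fromℚᵘ-+ (mkℚᵘ (+ m) 0) (mkℚᵘ (+ n) 0))
    where
    eq : + (m ℕ.+ n) ℤ.* + 1 ≡ (+ m ℤ.* + 1 ℤ.+ + n ℤ.* + 1) ℤ.* + 1
    eq = cong (ℤ._* + 1) (trans (ℤ.pos-+ m n)
           (sym (cong₂ ℤ._+_ (ℤ.*-identityʳ (+ m)) (ℤ.*-identityʳ (+ n)))))

  ℕtoℚ-* : ∀ m n → ℕtoℚ (m ℕ.* n) ≡ ℕtoℚ m * ℕtoℚ n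
  ℕtoℚ-* m n = trans (fromℚᵘ-cong {mkℚᵘ (+ (m ℕ.* n)) 0} {mkℚᵘ (+ m) 0 ℚᵘ.* mkℚᵘ (+ n) 0} (*≡* eq))
                     (fromℚᵘ-* (mkℚᵘ (+ m) 0) (mkℚᵘ (+ n) 0))
    where
    eq : + (m ℕ.* n) ℤ.* + 1 ≡ (+ m ℤ.* + n) ℤ.* + 1
    eq = cong (ℤ._* + 1) (ℤ.pos-* m n)

  ℕtoℚ*invℕ≡1 : ∀ m → ℕtoℚ (suc m) * invℕ (suc m) ≡ 1ℚ
  ℕtoℚ*invℕ≡1 m = trans (sym (fromℚᵘ-* (mkℚᵘ (+ suc m) 0) (mkℚᵘ (+ 1) m)))
    (fromℚᵘ-cong {mkℚᵘ (+ suc m) 0 ℚᵘ.* mkℚᵘ (+ 1) m} {mkℚᵘ (+ 1) 0}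
      (*≡* (cong (λ k → + suc k) (trans (ℕ.*-identityʳ (m ℕ.* 1))
        (trans (ℕ.*-identityʳ m) (sym (trans (ℕ.+-identityʳ (m ℕ.+ 0)) (ℕ.+-identityʳ m))))))))

  invℕ-* : ∀ m n → invℕ (m ℕ.* n) ≡ invℕ m * invℕ n
  invℕ-* zero    n       = sym (*-zeroˡ (invℕ n))
  invℕ-* (suc m) zero    = trans (cong invℕ (ℕ.*-zeroʳ m)) (sym (*-zeroʳ (invℕ (suc m))))
  invℕ-* (suc m) (suc n) = fromℚᵘ-* (mkℚᵘ (+ 1) m) (mkℚᵘ (+ 1) n)

  H-suc : ∀ m → H (suc m) ≡ H m + invℕ (suc m)
  H-suc m = cong (λ k → H m + invℕ k) (ℕ.*-identityʳ (suc m))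

  H²-suc : ∀ m → H^ 2 (suc m) ≡ H^ 2 m + invℕ (suc m) * invℕ (suc m)
  H²-suc m = cong (_+_ (H^ 2 m))
    (trans (cong (λ k → invℕ (suc m ℕ.* k)) (ℕ.*-identityʳ (suc m))) (invℕ-* (suc m) (suc m)))

  sumFrom1-suc : ∀ n f → sumFrom1 (suc n) f ≡ f 1 + sumFrom1 n (λ k → f (suc k))
  sumFrom1-suc zero    f = trans (+-identityˡ (f 1)) (sym (+-identityʳ (f 1)))
  sumFrom1-suc (suc n) f = trans (cong (_+ f (suc (suc n))) (sumFrom1-suc n f)) (+-assoc (f 1) _ _)

  sumFrom1-cong : ∀ n {f g : ℕ → ℚ} → (∀ k → k ℕ.< n → f (suc k) ≡ g (suc k)) → sumFrom1 n f ≡ sumFrom1 n g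
  sumFrom1-cong zero    f≡g = refl
  sumFrom1-cong (suc n) f≡g = cong₂ _+_ (sumFrom1-cong n (λ k k<n → f≡g k (ℕ.m<n⇒m<1+n k<n))) (f≡g n (ℕ.n<1+n n))

  sumFrom1-*ˡ : ∀ n a f → sumFrom1 n (λ k → a * f k) ≡ a * sumFrom1 n f
  sumFrom1-*ˡ zero    a f = sym (*-zeroʳ a)
  sumFrom1-*ˡ (suc n) a f = trans (cong (_+ a * f (suc n)) (sumFrom1-*ˡ n a f)) (sym (*-distribˡ-+ a _ _))

  sumBelow-cong : ∀ n {f g : ℕ → ℚ} → (∀ k → f k ≡ g k) → sumBelow n f ≡ sumBelow n g
  sumBelow-cong zero    f≡g = refl
  sumBelow-cong (suc n) f≡g = cong₂ _+_ (sumBelow-cong n f≡g) (f≡g n)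

  ℚ-ring : AlmostCommutativeRing _ _
  ℚ-ring = fromCommutativeRing +-*-commutativeRing isZero?
    where
    isZero? : ∀ q → Maybe (0ℚ ≡ q)
    isZero? q with 0ℚ ≟ q
    ... | yes e = just e
    ... | no _  = nothing

  invℕ-cancel : ∀ a m s → ℕtoℚ (suc a) * (s * invℕ (suc a ℕ.* m)) ≡ s * invℕ m
  invℕ-cancel a m s = begin
      ℕtoℚ (suc a) * (s * invℕ (suc a ℕ.* m))
    ≡⟨ cong (λ t → ℕtoℚ (suc a) * (s * t)) (invℕ-* (suc a) m) ⟩
      ℕtoℚ (suc a) * (s * (invℕ (suc a) * invℕ m))
    ≡⟨ regroup (ℕtoℚ (suc a)) s (invℕ (suc a)) (invℕ m) ⟩
      (ℕtoℚ (suc a) * invℕ (suc a)) * (s * invℕ m)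
    ≡⟨ cong (_* (s * invℕ m)) (ℕtoℚ*invℕ≡1 a) ⟩
      1ℚ * (s * invℕ m)
    ≡⟨ *-identityˡ _ ⟩
      s * invℕ m ∎
    where
    open ≡-Reasoning
    regroup : ∀ a s i m → a * (s * (i * m)) ≡ (a * i) * (s * m)
    regroup = solve-∀ ℚ-ring

module Binomial where
  open import Data.Nat
  open import Data.Nat.Properties
  open import Data.Nat.Combinatorics using (_C_; nCn≡1; nCk+nC[k+1]≡[n+1]C[k+1])
  open import Relation.Binary.PropositionalEquality
  open import Data.Nat.Tactic.RingSolver using (solve-∀)

  -- binom i j is the binomial coefficient (i + j) C i, indexed by the two parts.
  binom : ℕ → ℕ → ℕ
  binom zero    j       = 1
  binom (suc i) zero    = 1
  binom (suc i) (suc j) = binom i (suc j) + binom (suc i) j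

  binom*factorials≡factorial : ∀ i j → binom i j * (i ! * j !) ≡ (i + j) !
  binom*factorials≡factorial zero    j       = trans (*-identityˡ _) (*-identityˡ _)
  binom*factorials≡factorial (suc i) zero    =
    trans (+-identityʳ _) (trans (*-identityʳ _) (cong _! (sym (+-identityʳ (suc i)))))
  binom*factorials≡factorial (suc i) (suc j) = begin
      (binom i (suc j) + binom (suc i) j) * (suc i ! * suc j !)
    ≡⟨ regroup (binom i (suc j)) (binom (suc i) j) i j (i !) (j !) ⟩
      suc i * (binom i (suc j) * (i ! * suc j !)) + suc j * (binom (suc i) j * (suc i ! * j !))
    ≡⟨ cong₂ (λ u v → suc i * u + suc j * v) (binom*factorials≡factorial i (suc j))
         (trans (binom*factorials≡factorial (suc i) j) (cong _! (sym (+-suc i j)))) ⟩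
      suc i * (i + suc j) ! + suc j * (i + suc j) !
    ≡⟨ *-distribʳ-+ ((i + suc j) !) (suc i) (suc j) ⟨
      (suc i + suc j) ! ∎
    where
    open ≡-Reasoning
    regroup : ∀ a b i j I J → (a + b) * ((1 + i) * I * ((1 + j) * J))
            ≡ (1 + i) * (a * (I * ((1 + j) * J))) + (1 + j) * (b * ((1 + i) * I * J))
    regroup = solve-∀

  private
    factorials≢0 : ∀ i j → NonZero (i ! * j !)
    factorials≢0 i j = m*n≢0 (i !) (j !) {{i !≢0}} {{j !≢0}}

  suc-*-binom-sucʳ : ∀ i j → suc j * binom i (suc j) ≡ suc (i + j) * binom i j
  suc-*-binom-sucʳ i j = *-cancelʳ-≡ _ _ (i ! * j !) {{factorials≢0 i j}} (begin
      suc j * binom i (suc j) * (i ! * j !)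
    ≡⟨ shuffle (suc j) (binom i (suc j)) (i !) (j !) ⟩
      binom i (suc j) * (i ! * suc j !)
    ≡⟨ binom*factorials≡factorial i (suc j) ⟩
      (i + suc j) !
    ≡⟨ cong _! (+-suc i j) ⟩
      suc (i + j) * (i + j) !
    ≡⟨ cong (suc (i + j) *_) (binom*factorials≡factorial i j) ⟨
      suc (i + j) * (binom i j * (i ! * j !))
    ≡⟨ *-assoc (suc (i + j)) (binom i j) _ ⟨
      suc (i + j) * binom i j * (i ! * j !) ∎)
    where
    open ≡-Reasoning
    shuffle : ∀ s B I J → s * B * (I * J) ≡ B * (I * (s * J))
    shuffle = solve-∀

  suc-*-binom-sucˡ : ∀ i j → suc i * binom (suc i) j ≡ suc (i + j) * binom i j
  suc-*-binom-sucˡ i j = *-cancelʳ-≡ _ _ (i ! * j !) {{factorials≢0 i j}} (begin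
      suc i * binom (suc i) j * (i ! * j !)
    ≡⟨ shuffle (suc i) (binom (suc i) j) (i !) (j !) ⟩
      binom (suc i) j * (suc i ! * j !)
    ≡⟨ binom*factorials≡factorial (suc i) j ⟩
      suc (i + j) * (i + j) !
    ≡⟨ cong (suc (i + j) *_) (binom*factorials≡factorial i j) ⟨
      suc (i + j) * (binom i j * (i ! * j !))
    ≡⟨ *-assoc (suc (i + j)) (binom i j) _ ⟨
      suc (i + j) * binom i j * (i ! * j !) ∎)
    where
    open ≡-Reasoning
    shuffle : ∀ s B I J → s * B * (I * J) ≡ B * (s * I * J)
    shuffle = solve-∀

  [i+j]Ci≡binom : ∀ i j → (i + j) C i ≡ binom i j
  [i+j]Ci≡binom zero    j       = refl
  [i+j]Ci≡binom (suc i) zero    = trans (cong (_C suc i) (+-identityʳ (suc i))) (nCn≡1 (suc i))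
  [i+j]Ci≡binom (suc i) (suc j) = begin
      (suc i + suc j) C suc i
    ≡⟨ nCk+nC[k+1]≡[n+1]C[k+1] (i + suc j) i ⟨
      (i + suc j) C i + (i + suc j) C suc i
    ≡⟨ cong₂ _+_ ([i+j]Ci≡binom i (suc j))
         (trans (cong (_C suc i) (+-suc i j)) ([i+j]Ci≡binom (suc i) j)) ⟩
      binom i (suc j) + binom (suc i) j ∎
    where open ≡-Reasoning

  nCk≡binom : ∀ {n k} → k ≤ n → n C k ≡ binom k (n ∸ k)
  nCk≡binom {n} {k} k≤n = trans (cong (_C k) (sym (m+[n∸m]≡n k≤n))) ([i+j]Ci≡binom k (n ∸ k))

module Weights where
  open Arithmetic
  open Binomial
  open import Data.Nat.Combinatorics using (nCk≡nC[n∸k]; nC1≡n)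
  open import Algebra.Properties.CommutativeSemigroup ℕ.*-commutativeSemigroup using (xy∙z≈y∙xz; x∙yz≈y∙xz)
  open import Data.Product using (∃-syntax)
  open import Data.Rational using (_*_; -_)
  open import Data.Rational.Properties
  open import Relation.Binary.PropositionalEquality
  open import Tactic.RingSolver using (solve-∀)

  weight : ℕ → ℕ → ℚ
  weight n k = signQ k * invℕ (suc k ℕ.* (n ∸ k) ℕ.* (n C k))

  -- The coefficients of the telescoping sum behind the recurrence of the right-hand side.
  shiftedWeight : ℕ → ℕ → ℚ
  shiftedWeight n zero    = - 1ℚ
  shiftedWeight n (suc k) = ℕtoℚ (suc k) * ℕtoℚ (suc k) * weight n k

  private
    weight-+ : ∀ k j → weight (k ℕ.+ j) k ≡ signQ k * invℕ (suc k ℕ.* j ℕ.* binom k j)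
    weight-+ k j = cong₂ (λ a b → signQ k * invℕ (suc k ℕ.* a ℕ.* b)) (ℕ.m+n∸m≡n k j) ([i+j]Ci≡binom k j)

    decompose : ∀ {k p} → k ℕ.< p → ∃[ j ] k ℕ.+ suc j ≡ p
    decompose {k} k<p with ℕ.m≤n⇒∃[o]m+o≡n k<p
    ... | j , e = j , trans (ℕ.+-suc k j) e

  suc*weight : ∀ k j → ℕtoℚ (suc j) * weight (k ℕ.+ suc j) k ≡ signQ k * invℕ (suc k ℕ.* binom k (suc j))
  suc*weight k j = begin
      ℕtoℚ (suc j) * weight (k ℕ.+ suc j) k
    ≡⟨ cong (ℕtoℚ (suc j) *_) (weight-+ k (suc j)) ⟩
      ℕtoℚ (suc j) * (signQ k * invℕ (suc k ℕ.* suc j ℕ.* binom k (suc j)))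
    ≡⟨ cong (λ m → ℕtoℚ (suc j) * (signQ k * invℕ m)) (xy∙z≈y∙xz (suc k) (suc j) (binom k (suc j))) ⟩
      ℕtoℚ (suc j) * (signQ k * invℕ (suc j ℕ.* (suc k ℕ.* binom k (suc j))))
    ≡⟨ invℕ-cancel j (suc k ℕ.* binom k (suc j)) (signQ k) ⟩
      signQ k * invℕ (suc k ℕ.* binom k (suc j)) ∎
    where open ≡-Reasoning

  weight-suc : ∀ {p k} → k ℕ.< p → ℕtoℚ (suc p) * weight (suc p) k ≡ ℕtoℚ (p ∸ k) * weight p k
  weight-suc {p} {k} k<p with decompose k<p
  ... | j , refl = begin
      ℕtoℚ (suc (k ℕ.+ suc j)) * weight (suc (k ℕ.+ suc j)) k
    ≡⟨ cong (ℕtoℚ (suc (k ℕ.+ suc j)) *_)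
         (trans (cong (λ n → weight n k) (sym (ℕ.+-suc k (suc j)))) (weight-+ k (suc (suc j)))) ⟩
      ℕtoℚ (suc (k ℕ.+ suc j)) * (signQ k * invℕ (suc k ℕ.* suc (suc j) ℕ.* binom k (suc (suc j))))
    ≡⟨ cong (λ m → ℕtoℚ (suc (k ℕ.+ suc j)) * (signQ k * invℕ m)) absorb ⟩
      ℕtoℚ (suc (k ℕ.+ suc j)) * (signQ k * invℕ (suc (k ℕ.+ suc j) ℕ.* (suc k ℕ.* binom k (suc j))))
    ≡⟨ invℕ-cancel (k ℕ.+ suc j) (suc k ℕ.* binom k (suc j)) (signQ k) ⟩
      signQ k * invℕ (suc k ℕ.* binom k (suc j))
    ≡⟨ suc*weight k j ⟨
      ℕtoℚ (suc j) * weight (k ℕ.+ suc j) k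
    ≡⟨ cong (λ m → ℕtoℚ m * weight (k ℕ.+ suc j) k) (ℕ.m+n∸m≡n k (suc j)) ⟨
      ℕtoℚ (k ℕ.+ suc j ∸ k) * weight (k ℕ.+ suc j) k ∎
    where
    open ≡-Reasoning
    absorb : suc k ℕ.* suc (suc j) ℕ.* binom k (suc (suc j)) ≡ suc (k ℕ.+ suc j) ℕ.* (suc k ℕ.* binom k (suc j))
    absorb = trans (ℕ.*-assoc (suc k) (suc (suc j)) (binom k (suc (suc j))))
      (trans (cong (suc k ℕ.*_) (suc-*-binom-sucʳ k (suc j))) (x∙yz≈y∙xz (suc k) (suc (k ℕ.+ suc j)) (binom k (suc j))))

  shiftedWeight-+ : ∀ k j → shiftedWeight (k ℕ.+ suc j) k ≡ - (signQ k * invℕ (binom k (suc j)))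
  shiftedWeight-+ zero    j = refl
  shiftedWeight-+ (suc i) j = begin
      ℕtoℚ (suc i) * ℕtoℚ (suc i) * weight (suc i ℕ.+ suc j) i
    ≡⟨ cong (ℕtoℚ (suc i) * ℕtoℚ (suc i) *_)
         (trans (cong (λ n → weight n i) (sym (ℕ.+-suc i (suc j)))) (weight-+ i (suc (suc j)))) ⟩
      ℕtoℚ (suc i) * ℕtoℚ (suc i) * (signQ i * invℕ (suc i ℕ.* suc (suc j) ℕ.* binom i (suc (suc j))))
    ≡⟨ cong (λ m → ℕtoℚ (suc i) * ℕtoℚ (suc i) * (signQ i * invℕ m)) absorb ⟩
      ℕtoℚ (suc i) * ℕtoℚ (suc i) * (signQ i * invℕ (suc i ℕ.* (suc i ℕ.* binom (suc i) (suc j))))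
    ≡⟨ *-assoc (ℕtoℚ (suc i)) (ℕtoℚ (suc i)) _ ⟩
      ℕtoℚ (suc i) * (ℕtoℚ (suc i) * (signQ i * invℕ (suc i ℕ.* (suc i ℕ.* binom (suc i) (suc j)))))
    ≡⟨ cong (ℕtoℚ (suc i) *_) (invℕ-cancel i (suc i ℕ.* binom (suc i) (suc j)) (signQ i)) ⟩
      ℕtoℚ (suc i) * (signQ i * invℕ (suc i ℕ.* binom (suc i) (suc j)))
    ≡⟨ invℕ-cancel i (binom (suc i) (suc j)) (signQ i) ⟩
      signQ i * invℕ (binom (suc i) (suc j))
    ≡⟨ -[-s*m]≡s*m (signQ i) (invℕ (binom (suc i) (suc j))) ⟨
      - (signQ (suc i) * invℕ (binom (suc i) (suc j))) ∎
    where
    open ≡-Reasoning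
    absorb : suc i ℕ.* suc (suc j) ℕ.* binom i (suc (suc j)) ≡ suc i ℕ.* (suc i ℕ.* binom (suc i) (suc j))
    absorb = trans (ℕ.*-assoc (suc i) (suc (suc j)) (binom i (suc (suc j))))
      (cong (suc i ℕ.*_) (trans (suc-*-binom-sucʳ i (suc j)) (sym (suc-*-binom-sucˡ i (suc j)))))
    -[-s*m]≡s*m : ∀ s m → - ((- s) * m) ≡ s * m
    -[-s*m]≡s*m = solve-∀ ℚ-ring

  shiftedWeight≡ : ∀ {p k} → k ℕ.< p → shiftedWeight p k ≡ - (ℕtoℚ (suc k) * ℕtoℚ (p ∸ k) * weight p k)
  shiftedWeight≡ {p} {k} k<p with decompose k<p
  ... | j , refl = begin
      shiftedWeight (k ℕ.+ suc j) k
    ≡⟨ shiftedWeight-+ k j ⟩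
      - (signQ k * invℕ (binom k (suc j)))
    ≡⟨ cong -_ (invℕ-cancel k (binom k (suc j)) (signQ k)) ⟨
      - (ℕtoℚ (suc k) * (signQ k * invℕ (suc k ℕ.* binom k (suc j))))
    ≡⟨ cong (λ t → - (ℕtoℚ (suc k) * t)) (suc*weight k j) ⟨
      - (ℕtoℚ (suc k) * (ℕtoℚ (suc j) * weight (k ℕ.+ suc j) k))
    ≡⟨ cong -_ (*-assoc (ℕtoℚ (suc k)) (ℕtoℚ (suc j)) _) ⟨
      - (ℕtoℚ (suc k) * ℕtoℚ (suc j) * weight (k ℕ.+ suc j) k)
    ≡⟨ cong (λ m → - (ℕtoℚ (suc k) * ℕtoℚ m * weight (k ℕ.+ suc j) k)) (ℕ.m+n∸m≡n k (suc j)) ⟨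
      - (ℕtoℚ (suc k) * ℕtoℚ (k ℕ.+ suc j ∸ k) * weight (k ℕ.+ suc j) k) ∎
    where open ≡-Reasoning

  weight-last : ∀ p → ℕtoℚ (suc p) * ℕtoℚ (suc p) * weight (suc p) p ≡ signQ p
  weight-last p = begin
      ℕtoℚ (suc p) * ℕtoℚ (suc p) * weight (suc p) p
    ≡⟨ cong₂ (λ a b → ℕtoℚ (suc p) * ℕtoℚ (suc p) * (signQ p * invℕ (suc p ℕ.* a ℕ.* b)))
         (suc[n]∸n≡1 p) (trans (nCk≡nC[n∸k] (ℕ.n≤1+n p)) (trans (cong (suc p C_) (suc[n]∸n≡1 p)) (nC1≡n (suc p)))) ⟩
      ℕtoℚ (suc p) * ℕtoℚ (suc p) * (signQ p * invℕ (suc p ℕ.* 1 ℕ.* suc p))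
    ≡⟨ cong (λ m → ℕtoℚ (suc p) * ℕtoℚ (suc p) * (signQ p * invℕ m)) (ℕ.*-comm (suc p ℕ.* 1) (suc p)) ⟩
      ℕtoℚ (suc p) * ℕtoℚ (suc p) * (signQ p * invℕ (suc p ℕ.* (suc p ℕ.* 1)))
    ≡⟨ *-assoc (ℕtoℚ (suc p)) (ℕtoℚ (suc p)) _ ⟩
      ℕtoℚ (suc p) * (ℕtoℚ (suc p) * (signQ p * invℕ (suc p ℕ.* (suc p ℕ.* 1))))
    ≡⟨ cong (ℕtoℚ (suc p) *_) (invℕ-cancel p (suc p ℕ.* 1) (signQ p)) ⟩
      ℕtoℚ (suc p) * (signQ p * invℕ (suc p ℕ.* 1))
    ≡⟨ invℕ-cancel p 1 (signQ p) ⟩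
      signQ p * invℕ 1
    ≡⟨ *-identityʳ (signQ p) ⟩
      signQ p ∎
    where
    open ≡-Reasoning
    suc[n]∸n≡1 : ∀ n → suc n ∸ n ≡ 1
    suc[n]∸n≡1 zero    = refl
    suc[n]∸n≡1 (suc n) = suc[n]∸n≡1 n

  shiftedWeight-diag : ∀ p → shiftedWeight p p ≡ - signQ p
  shiftedWeight-diag zero    = refl
  shiftedWeight-diag (suc p) = trans (weight-last p) (sym (-‿involutive (signQ p)))
    where
    -‿involutive : ∀ s → - (- s) ≡ s
    -‿involutive = solve-∀ ℚ-ring

open Arithmetic
open Binomial
open Weights

module Truncated {c ℓ} (R : CommutativeRing c ℓ) where
  open CommutativeRing R
  open NatSolver commutativeSemiring using (solve; _:+_; _:*_; _:=_; con)

  -- ⟨ a₀ , a₁ , a₂ ⟩ stands for a₀ + a₁ ε + a₂ ε² in R[ε]/(ε³).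
  record Trunc : Set c where
    constructor ⟨_,_,_⟩
    field
      c₀ c₁ c₂ : Carrier
  open Trunc public

  infix 4 _≋_
  record _≋_ (a b : Trunc) : Set ℓ where
    constructor ≋⟨_,_,_⟩
    field
      c₀-≈ : c₀ a ≈ c₀ b
      c₁-≈ : c₁ a ≈ c₁ b
      c₂-≈ : c₂ a ≈ c₂ b
  open _≋_ public

  infixl 6 _⊕_
  infixl 7 _⊗_
  _⊕_ _⊗_ : Trunc → Trunc → Trunc
  a ⊕ b = ⟨ c₀ a + c₀ b , c₁ a + c₁ b , c₂ a + c₂ b ⟩
  a ⊗ b = ⟨ c₀ a * c₀ b , c₀ a * c₁ b + c₁ a * c₀ b , c₀ a * c₂ b + c₁ a * c₁ b + c₂ a * c₀ b ⟩

  ⊖_ : Trunc → Trunc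
  ⊖ a = ⟨ - c₀ a , - c₁ a , - c₂ a ⟩

  𝟘 𝟙 ε : Trunc
  𝟘 = ⟨ 0# , 0# , 0# ⟩
  𝟙 = ⟨ 1# , 0# , 0# ⟩
  ε = ⟨ 0# , 1# , 0# ⟩

  private
    *-assoc₁ : ∀ a₀ a₁ b₀ b₁ c₀ c₁ →
      (a₀ * b₀) * c₁ + (a₀ * b₁ + a₁ * b₀) * c₀ ≈ a₀ * (b₀ * c₁ + b₁ * c₀) + a₁ * (b₀ * c₀)
    *-assoc₁ = solve 6 (λ a₀ a₁ b₀ b₁ c₀ c₁ →
      (a₀ :* b₀) :* c₁ :+ (a₀ :* b₁ :+ a₁ :* b₀) :* c₀ := a₀ :* (b₀ :* c₁ :+ b₁ :* c₀) :+ a₁ :* (b₀ :* c₀)) refl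
    *-assoc₂ : ∀ a₀ a₁ a₂ b₀ b₁ b₂ c₀ c₁ c₂ →
      (a₀ * b₀) * c₂ + (a₀ * b₁ + a₁ * b₀) * c₁ + (a₀ * b₂ + a₁ * b₁ + a₂ * b₀) * c₀
        ≈ a₀ * (b₀ * c₂ + b₁ * c₁ + b₂ * c₀) + a₁ * (b₀ * c₁ + b₁ * c₀) + a₂ * (b₀ * c₀)
    *-assoc₂ = solve 9 (λ a₀ a₁ a₂ b₀ b₁ b₂ c₀ c₁ c₂ →
      (a₀ :* b₀) :* c₂ :+ (a₀ :* b₁ :+ a₁ :* b₀) :* c₁ :+ (a₀ :* b₂ :+ a₁ :* b₁ :+ a₂ :* b₀) :* c₀
        := a₀ :* (b₀ :* c₂ :+ b₁ :* c₁ :+ b₂ :* c₀) :+ a₁ :* (b₀ :* c₁ :+ b₁ :* c₀) :+ a₂ :* (b₀ :* c₀)) refl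
    *-comm₁ : ∀ a₀ a₁ b₀ b₁ → a₀ * b₁ + a₁ * b₀ ≈ b₀ * a₁ + b₁ * a₀
    *-comm₁ = solve 4 (λ a₀ a₁ b₀ b₁ → a₀ :* b₁ :+ a₁ :* b₀ := b₀ :* a₁ :+ b₁ :* a₀) refl
    *-comm₂ : ∀ a₀ a₁ a₂ b₀ b₁ b₂ → a₀ * b₂ + a₁ * b₁ + a₂ * b₀ ≈ b₀ * a₂ + b₁ * a₁ + b₂ * a₀
    *-comm₂ = solve 6 (λ a₀ a₁ a₂ b₀ b₁ b₂ →
      a₀ :* b₂ :+ a₁ :* b₁ :+ a₂ :* b₀ := b₀ :* a₂ :+ b₁ :* a₁ :+ b₂ :* a₀) refl
    *-identityˡ₁ : ∀ a₀ a₁ → 1# * a₁ + 0# * a₀ ≈ a₁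
    *-identityˡ₁ = solve 2 (λ a₀ a₁ → con 1 :* a₁ :+ con 0 :* a₀ := a₁) refl
    *-identityˡ₂ : ∀ a₀ a₁ a₂ → 1# * a₂ + 0# * a₁ + 0# * a₀ ≈ a₂
    *-identityˡ₂ = solve 3 (λ a₀ a₁ a₂ → con 1 :* a₂ :+ con 0 :* a₁ :+ con 0 :* a₀ := a₂) refl
    distribˡ₁ : ∀ a₀ a₁ b₀ b₁ c₀ c₁ →
      a₀ * (b₁ + c₁) + a₁ * (b₀ + c₀) ≈ (a₀ * b₁ + a₁ * b₀) + (a₀ * c₁ + a₁ * c₀)
    distribˡ₁ = solve 6 (λ a₀ a₁ b₀ b₁ c₀ c₁ →
      a₀ :* (b₁ :+ c₁) :+ a₁ :* (b₀ :+ c₀) := (a₀ :* b₁ :+ a₁ :* b₀) :+ (a₀ :* c₁ :+ a₁ :* c₀)) refl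
    distribˡ₂ : ∀ a₀ a₁ a₂ b₀ b₁ b₂ c₀ c₁ c₂ →
      a₀ * (b₂ + c₂) + a₁ * (b₁ + c₁) + a₂ * (b₀ + c₀)
        ≈ (a₀ * b₂ + a₁ * b₁ + a₂ * b₀) + (a₀ * c₂ + a₁ * c₁ + a₂ * c₀)
    distribˡ₂ = solve 9 (λ a₀ a₁ a₂ b₀ b₁ b₂ c₀ c₁ c₂ →
      a₀ :* (b₂ :+ c₂) :+ a₁ :* (b₁ :+ c₁) :+ a₂ :* (b₀ :+ c₀)
        := (a₀ :* b₂ :+ a₁ :* b₁ :+ a₂ :* b₀) :+ (a₀ :* c₂ :+ a₁ :* c₁ :+ a₂ :* c₀)) refl

  ≋-refl : ∀ {a} → a ≋ a
  ≋-refl = ≋⟨ refl , refl , refl ⟩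

  ≋-sym : ∀ {a b} → a ≋ b → b ≋ a
  ≋-sym ≋⟨ p , q , r ⟩ = ≋⟨ sym p , sym q , sym r ⟩

  ≋-trans : ∀ {a b c} → a ≋ b → b ≋ c → a ≋ c
  ≋-trans ≋⟨ p , q , r ⟩ ≋⟨ p′ , q′ , r′ ⟩ = ≋⟨ trans p p′ , trans q q′ , trans r r′ ⟩

  ⊗-comm : ∀ a b → a ⊗ b ≋ b ⊗ a
  ⊗-comm a b = ≋⟨ *-comm _ _ , *-comm₁ _ _ _ _ , *-comm₂ _ _ _ _ _ _ ⟩

  ⊕-⊗-isCommutativeRing : IsCommutativeRing _≋_ _⊕_ _⊗_ ⊖_ 𝟘 𝟙
  ⊕-⊗-isCommutativeRing = record
    { isRing = record
      { +-isAbelianGroup = record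
        { isGroup = record
          { isMonoid = record
            { isSemigroup = record
              { isMagma = record
                { isEquivalence = record { refl = ≋-refl ; sym = ≋-sym ; trans = ≋-trans }
                ; ∙-cong = λ where
                    ≋⟨ p , q , r ⟩ ≋⟨ p′ , q′ , r′ ⟩ → ≋⟨ +-cong p p′ , +-cong q q′ , +-cong r r′ ⟩
                }
              ; assoc = λ _ _ _ → ≋⟨ +-assoc _ _ _ , +-assoc _ _ _ , +-assoc _ _ _ ⟩
              }
            ; identity = (λ _ → ≋⟨ +-identityˡ _ , +-identityˡ _ , +-identityˡ _ ⟩)
                       , (λ _ → ≋⟨ +-identityʳ _ , +-identityʳ _ , +-identityʳ _ ⟩)
            }
          ; inverse = (λ _ → ≋⟨ -‿inverseˡ _ , -‿inverseˡ _ , -‿inverseˡ _ ⟩)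
                    , (λ _ → ≋⟨ -‿inverseʳ _ , -‿inverseʳ _ , -‿inverseʳ _ ⟩)
          ; ⁻¹-cong = λ where ≋⟨ p , q , r ⟩ → ≋⟨ -‿cong p , -‿cong q , -‿cong r ⟩
          }
        ; comm = λ _ _ → ≋⟨ +-comm _ _ , +-comm _ _ , +-comm _ _ ⟩
        }
      ; *-cong = λ where
          ≋⟨ p , q , r ⟩ ≋⟨ p′ , q′ , r′ ⟩ →
            ≋⟨ *-cong p p′ , +-cong (*-cong p q′) (*-cong q p′)
             , +-cong (+-cong (*-cong p r′) (*-cong q q′)) (*-cong r p′) ⟩
      ; *-assoc = λ _ _ _ → ≋⟨ *-assoc _ _ _ , *-assoc₁ _ _ _ _ _ _ , *-assoc₂ _ _ _ _ _ _ _ _ _ ⟩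
      ; *-identity = identityˡ , λ a → ≋-trans (⊗-comm a 𝟙) (identityˡ a)
      ; distrib = distribˡ′ , λ a b c →
          ≋-trans (⊗-comm (b ⊕ c) a) (≋-trans (distribˡ′ a b c)
            (≋⟨ +-cong (*-comm _ _) (*-comm _ _) , +-cong (*-comm₁ _ _ _ _) (*-comm₁ _ _ _ _)
              , +-cong (*-comm₂ _ _ _ _ _ _) (*-comm₂ _ _ _ _ _ _) ⟩))
      }
    ; *-comm = ⊗-comm
    }
    where
    identityˡ : ∀ a → 𝟙 ⊗ a ≋ a
    identityˡ _ = ≋⟨ *-identityˡ _ , *-identityˡ₁ _ _ , *-identityˡ₂ _ _ _ ⟩
    distribˡ′ : ∀ a b c → a ⊗ (b ⊕ c) ≋ a ⊗ b ⊕ a ⊗ c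
    distribˡ′ _ _ _ = ≋⟨ distribˡ _ _ _ , distribˡ₁ _ _ _ _ _ _ , distribˡ₂ _ _ _ _ _ _ _ _ _ ⟩

  ⊕-⊗-commutativeRing : CommutativeRing c ℓ
  ⊕-⊗-commutativeRing = record { isCommutativeRing = ⊕-⊗-isCommutativeRing }

  const : Carrier → Trunc
  const a = ⟨ a , 0# , 0# ⟩

  const-cong : ∀ {a b} → a ≈ b → const a ≋ const b
  const-cong e = ≋⟨ e , refl , refl ⟩

  const-+ : ∀ a b → const (a + b) ≋ const a ⊕ const b
  const-+ a b = ≋⟨ refl , sym (+-identityʳ 0#) , sym (+-identityʳ 0#) ⟩

  const-* : ∀ a b → const (a * b) ≋ const a ⊗ const b
  const-* a b = ≋⟨ refl , zero₁ a b , zero₂ a b ⟩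
    where
    zero₁ : ∀ a b → 0# ≈ a * 0# + 0# * b
    zero₁ = solve 2 (λ a b → con 0 := a :* con 0 :+ con 0 :* b) refl
    zero₂ : ∀ a b → 0# ≈ a * 0# + 0# * 0# + 0# * b
    zero₂ = solve 2 (λ a b → con 0 := a :* con 0 :+ con 0 :* con 0 :+ con 0 :* b) refl

  const-neg : ∀ a → const (- a) ≋ ⊖ const a
  const-neg a = ≋⟨ refl , -0≈0 , -0≈0 ⟩
    where
    -0≈0 : 0# ≈ - 0#
    -0≈0 = sym (trans (sym (+-identityˡ (- 0#))) (-‿inverseʳ 0#))

  c₁-const-⊗ : ∀ a t → c₁ (const a ⊗ t) ≈ a * c₁ t
  c₁-const-⊗ a t = solve 3 (λ a t₀ t₁ → a :* t₁ :+ con 0 :* t₀ := a :* t₁) refl a (c₀ t) (c₁ t)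

  c₂-const-⊗ : ∀ a t → c₂ (const a ⊗ t) ≈ a * c₂ t
  c₂-const-⊗ a t = solve 4 (λ a t₀ t₁ t₂ → a :* t₂ :+ con 0 :* t₁ :+ con 0 :* t₀ := a :* t₂) refl a (c₀ t) (c₁ t) (c₂ t)

  c₁-⊗-const : ∀ t a → c₁ (t ⊗ const a) ≈ c₁ t * a
  c₁-⊗-const t a = solve 3 (λ a t₀ t₁ → t₀ :* con 0 :+ t₁ :* a := t₁ :* a) refl a (c₀ t) (c₁ t)

  c₂-⊗-const : ∀ t a → c₂ (t ⊗ const a) ≈ c₂ t * a
  c₂-⊗-const t a = solve 4 (λ a t₀ t₁ t₂ → t₀ :* con 0 :+ t₁ :* con 0 :+ t₂ :* a := t₂ :* a) refl a (c₀ t) (c₁ t) (c₂ t)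

  c₂-ε-⊗ : ∀ t → c₂ (ε ⊗ t) ≈ c₁ t
  c₂-ε-⊗ t = solve 3 (λ t₀ t₁ t₂ → con 0 :* t₂ :+ con 1 :* t₁ :+ con 0 :* t₀ := t₁) refl (c₀ t) (c₁ t) (c₂ t)

  const-isRingHomomorphism : IsRingHomomorphism rawRing (CommutativeRing.rawRing ⊕-⊗-commutativeRing) const
  const-isRingHomomorphism = record
    { isSemiringHomomorphism = record
      { isNearSemiringHomomorphism = record
        { +-isMonoidHomomorphism = record
          { isMagmaHomomorphism = record
            { isRelHomomorphism = record { cong = const-cong }
            ; homo = const-+
            }
          ; ε-homo = ≋-refl
          }
        ; *-homo = const-*
        }
      ; 1#-homo = ≋-refl
      }
    ; -‿homo = const-neg
    }

module TruncatedMap {c₁ ℓ₁ c₂ ℓ₂} (R : CommutativeRing c₁ ℓ₁) (S : CommutativeRing c₂ ℓ₂)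
  {f : CommutativeRing.Carrier R → CommutativeRing.Carrier S}
  (f-hom : IsRingHomomorphism (CommutativeRing.rawRing R) (CommutativeRing.rawRing S) f) where

  private
    module R = Truncated R
    module S = Truncated S
  open CommutativeRing S
  open IsRingHomomorphism f-hom

  map : R.Trunc → S.Trunc
  map a = S.⟨ f (R.c₀ a) , f (R.c₁ a) , f (R.c₂ a) ⟩

  map-isRingHomomorphism : IsRingHomomorphism (CommutativeRing.rawRing R.⊕-⊗-commutativeRing)
                                              (CommutativeRing.rawRing S.⊕-⊗-commutativeRing) map
  map-isRingHomomorphism = record
    { isSemiringHomomorphism = record
      { isNearSemiringHomomorphism = record
        { +-isMonoidHomomorphism = record
          { isMagmaHomomorphism = record
            { isRelHomomorphism = record { cong = λ where R.≋⟨ p , q , r ⟩ → S.≋⟨ ⟦⟧-cong p , ⟦⟧-cong q , ⟦⟧-cong r ⟩ }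
            ; homo = λ _ _ → S.≋⟨ +-homo _ _ , +-homo _ _ , +-homo _ _ ⟩
            }
          ; ε-homo = S.≋⟨ 0#-homo , 0#-homo , 0#-homo ⟩
          }
        ; *-homo = λ _ _ → S.≋⟨ *-homo _ _ , trans (+-homo _ _) (+-cong (*-homo _ _) (*-homo _ _))
                            , trans (+-homo _ _) (+-cong (trans (+-homo _ _) (+-cong (*-homo _ _) (*-homo _ _))) (*-homo _ _)) ⟩
        }
      ; 1#-homo = S.≋⟨ 1#-homo , 0#-homo , 0#-homo ⟩
      }
    ; -‿homo = λ _ → S.≋⟨ -‿homo _ , -‿homo _ , -‿homo _ ⟩
    }

module Recurrences {c ℓ} (R : CommutativeRing c ℓ) {ι : ℚ → CommutativeRing.Carrier R}
  (ι-hom : IsRingHomomorphism ℚ.+-*-rawRing (CommutativeRing.rawRing R) ι) where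

  open CommutativeRing R
  open IsRingHomomorphism ι-hom
    using () renaming (+-homo to ι-+; *-homo to ι-*; -‿homo to ι-neg; 0#-homo to ι-0; 1#-homo to ι-1)
  open RingProperties ring using (-0#≈0#)
  open import Relation.Binary.Reasoning.Setoid setoid

  private
    ℚ⟶R : ℚ.+-*-rawRing ACR.-Raw-AlmostCommutative⟶ ACR.fromCommutativeRing R
    ℚ⟶R = record { ⟦_⟧ = ι ; +-homo = ι-+ ; *-homo = ι-* ; -‿homo = ι-neg ; 0-homo = ι-0 ; 1-homo = ι-1 }

    ι-equal? : ∀ a b → Maybe (ι a ≈ ι b)
    ι-equal? a b with a ℚ.≟ b
    ... | yes ≡.refl = just refl
    ... | no _       = nothing

  open Algebra.Solver.Ring ℚ.+-*-rawRing (ACR.fromCommutativeRing R) ℚ⟶R ι-equal?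
    using (solve; _:=_; _:+_; _:*_; _:-_; :-_; con)

  ιℕ : ℕ → Carrier
  ιℕ m = ι (ℕtoℚ m)

  ιℕ-+ : ∀ m n → ιℕ (m ℕ.+ n) ≈ ιℕ m + ιℕ n
  ιℕ-+ m n = trans (reflexive (≡.cong ι (ℕtoℚ-+ m n))) (ι-+ _ _)

  ιℕ-* : ∀ m n → ιℕ (m ℕ.* n) ≈ ιℕ m * ιℕ n
  ιℕ-* m n = trans (reflexive (≡.cong ι (ℕtoℚ-* m n))) (ι-* _ _)

  sgn : ℕ → Carrier
  sgn i = ι (signQ i)

  B : ℕ → ℕ → Carrier
  B i j = ιℕ (binom i j)

  ιℕ-suc-*-B-sucʳ : ∀ i j → ιℕ (suc j) * B i (suc j) ≈ ιℕ (suc (i ℕ.+ j)) * B i j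
  ιℕ-suc-*-B-sucʳ i j = trans (sym (ιℕ-* (suc j) (binom i (suc j))))
    (trans (reflexive (≡.cong ιℕ (suc-*-binom-sucʳ i j))) (ιℕ-* (suc (i ℕ.+ j)) (binom i j)))

  ιℕ-suc-*-B-sucˡ : ∀ i j → ιℕ (suc i) * B (suc i) j ≈ ιℕ (suc (i ℕ.+ j)) * B i j
  ιℕ-suc-*-B-sucˡ i j = trans (sym (ιℕ-* (suc i) (binom (suc i) j)))
    (trans (reflexive (≡.cong ιℕ (suc-*-binom-sucˡ i j))) (ιℕ-* (suc (i ℕ.+ j)) (binom i j)))

  *-cancelˡ-invertible : ∀ {a a⁻¹ b b′} → a * a⁻¹ ≈ 1# → a * b ≈ a * b′ → b ≈ b′
  *-cancelˡ-invertible {a} {a⁻¹} {b} {b′} inverse a*b≈a*b′ = begin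
    b              ≈⟨ *-identityˡ b ⟨
    1# * b         ≈⟨ *-cong inverse refl ⟨
    a * a⁻¹ * b    ≈⟨ reassoc a a⁻¹ b ⟩
    a⁻¹ * (a * b)  ≈⟨ *-cong refl a*b≈a*b′ ⟩
    a⁻¹ * (a * b′) ≈⟨ reassoc a a⁻¹ b′ ⟨
    a * a⁻¹ * b′   ≈⟨ *-cong inverse refl ⟩
    1# * b′        ≈⟨ *-identityˡ b′ ⟩
    b′             ∎
    where
    reassoc : ∀ a a⁻¹ b → a * a⁻¹ * b ≈ a⁻¹ * (a * b)
    reassoc = solve 3 (λ a a⁻¹ b → a :* a⁻¹ :* b := a⁻¹ :* (a :* b)) refl

  Σ< : ℕ → (ℕ → Carrier) → Carrier
  Σ< zero    f = 0#
  Σ< (suc n) f = Σ< n f + f n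

  Σ<-cong : ∀ n {f g : ℕ → Carrier} → (∀ k → k ℕ.< n → f k ≈ g k) → Σ< n f ≈ Σ< n g
  Σ<-cong zero    f≈g = refl
  Σ<-cong (suc n) f≈g = +-cong (Σ<-cong n (λ k k<n → f≈g k (ℕ.m<n⇒m<1+n k<n))) (f≈g n (ℕ.n<1+n n))

  Σ<-- : ∀ n (f g : ℕ → Carrier) → Σ< n (λ k → f k - g k) ≈ Σ< n f - Σ< n g
  Σ<-- zero    f g = sym (-‿inverseʳ 0#)
  Σ<-- (suc n) f g = trans (+-cong (Σ<-- n f g) refl)
    (solve 4 (λ a b c d → (a :- b) :+ (c :- d) := (a :+ c) :- (b :+ d)) refl _ _ _ _)

  Σ<-*ˡ : ∀ n a (f : ℕ → Carrier) → Σ< n (λ k → a * f k) ≈ a * Σ< n f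
  Σ<-*ˡ zero    a f = sym (zeroʳ a)
  Σ<-*ˡ (suc n) a f = trans (+-cong (Σ<-*ˡ n a f) refl) (sym (distribˡ a _ _))

  Σ<-telescope : ∀ n (g : ℕ → Carrier) → Σ< n (λ k → g k - g (suc k)) ≈ g 0 - g n
  Σ<-telescope zero    g = sym (-‿inverseʳ (g 0))
  Σ<-telescope (suc n) g = trans (+-cong (Σ<-telescope n g) refl) (solve 3 (λ a b c → (a :- b) :+ (b :- c) := a :- c) refl _ _ _)

  -- convolve n f is the sum of f i j over i + j = n.
  convolve : ℕ → (ℕ → ℕ → Carrier) → Carrier
  convolve zero    f = f 0 0
  convolve (suc n) f = f 0 (suc n) + convolve n (λ i j → f (suc i) j)

  convolve-cong : ∀ n {f g : ℕ → ℕ → Carrier} → (∀ i j → i ℕ.+ j ≡.≡ n → f i j ≈ g i j) → convolve n f ≈ convolve n g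
  convolve-cong zero    f≈g = f≈g 0 0 ≡.refl
  convolve-cong (suc n) f≈g = +-cong (f≈g 0 (suc n) ≡.refl) (convolve-cong n (λ i j e → f≈g (suc i) j (≡.cong suc e)))

  convolve-+ : ∀ n (f g : ℕ → ℕ → Carrier) → convolve n (λ i j → f i j + g i j) ≈ convolve n f + convolve n g
  convolve-+ zero    f g = refl
  convolve-+ (suc n) f g = trans (+-cong refl (convolve-+ n _ _))
    (solve 4 (λ a b c d → (a :+ b) :+ (c :+ d) := (a :+ c) :+ (b :+ d)) refl _ _ _ _)

  convolve-*ˡ : ∀ n a (f : ℕ → ℕ → Carrier) → convolve n (λ i j → a * f i j) ≈ a * convolve n f
  convolve-*ˡ zero    a f = refl
  convolve-*ˡ (suc n) a f = trans (+-cong refl (convolve-*ˡ n a _)) (sym (distribˡ a _ _))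

  convolve-neg : ∀ n (f : ℕ → ℕ → Carrier) → convolve n (λ i j → - f i j) ≈ - convolve n f
  convolve-neg zero    f = refl
  convolve-neg (suc n) f = trans (+-cong refl (convolve-neg n _)) (solve 2 (λ a b → :- a :+ :- b := :- (a :+ b)) refl _ _)

  convolve-suc : ∀ n (f : ℕ → ℕ → Carrier) → convolve (suc n) f ≈ convolve n (λ i j → f i (suc j)) + f (suc n) 0
  convolve-suc zero    f = refl
  convolve-suc (suc n) f = trans (+-cong refl (convolve-suc n (λ i j → f (suc i) j))) (sym (+-assoc _ _ _))

  -- inv m stands for 1 / (m + 1 + z), Q k p for the product of j / (j + z) over k < j ≤ p,
  -- and alt m below for (-1)^(m+1) z / (m + 1 + z).
  record Reciprocals (z : Carrier) : Set (c ⊔ ℓ) where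
    field
      inv         : ℕ → Carrier
      inv-inverse : ∀ m → (ιℕ (suc m) + z) * inv m ≈ 1#
      Q           : ℕ → ℕ → Carrier
      Q-diag      : ∀ p → Q p p ≈ 1#
      Q-sucˡ      : ∀ k p → (ιℕ (suc k) + z) * Q k p ≈ ιℕ (suc k) * Q (suc k) p
      Q-sucʳ      : ∀ k p → (ιℕ (suc p) + z) * Q k (suc p) ≈ ιℕ (suc p) * Q k p

    u : ℕ → Carrier
    u = Q 0

    u-suc : ∀ j → (ιℕ (suc j) + z) * u (suc j) ≈ ιℕ (suc j) * u j
    u-suc = Q-sucʳ 0

    alt : ℕ → Carrier
    alt m = sgn (suc m) * z * inv m

    alt-correct : ∀ m → (ιℕ (suc m) + z) * alt m ≈ sgn (suc m) * z
    alt-correct m = begin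
      (ιℕ (suc m) + z) * (sgn (suc m) * z * inv m) ≈⟨ swap (ιℕ (suc m) + z) (sgn (suc m) * z) (inv m) ⟩
      sgn (suc m) * z * ((ιℕ (suc m) + z) * inv m) ≈⟨ *-cong refl (inv-inverse m) ⟩
      sgn (suc m) * z * 1#                         ≈⟨ *-identityʳ _ ⟩
      sgn (suc m) * z                              ∎
      where
      swap : ∀ a b c → a * (b * c) ≈ b * (a * c)
      swap = solve 3 (λ a b c → a :* (b :* c) := b :* (a :* c)) refl

  module BinomialConvolution {x} (X : Reciprocals x) where
    open Reciprocals X

    binomialConv : (ℕ → Carrier) → ℕ → Carrier
    binomialConv γ n = convolve n (λ i j → B i j * (γ i * u j))

    binomialConv-*ιℕ : ∀ m (γ : ℕ → Carrier) →
      binomialConv (λ i → ιℕ i * γ i) (suc m) ≈ ιℕ (suc m) * binomialConv (λ i → γ (suc i)) m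
    binomialConv-*ιℕ m γ = begin
        B 0 (suc m) * ((ιℕ 0 * γ 0) * u (suc m)) + convolve m (λ i j → B (suc i) j * ((ιℕ (suc i) * γ (suc i)) * u j))
      ≈⟨ +-cong first≈0 (convolve-cong m (λ i j i+j≡m → term i j i+j≡m)) ⟩
        0# + convolve m (λ i j → ιℕ (suc m) * (B i j * (γ (suc i) * u j)))
      ≈⟨ +-identityˡ _ ⟩
        convolve m (λ i j → ιℕ (suc m) * (B i j * (γ (suc i) * u j)))
      ≈⟨ convolve-*ˡ m _ _ ⟩
        ιℕ (suc m) * binomialConv (λ i → γ (suc i)) m ∎
      where
      first≈0 : B 0 (suc m) * ((ιℕ 0 * γ 0) * u (suc m)) ≈ 0#
      first≈0 = begin
        B 0 (suc m) * ((ιℕ 0 * γ 0) * u (suc m)) ≈⟨ *-cong refl (*-cong (*-cong ι-0 refl) refl) ⟩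
        B 0 (suc m) * ((0# * γ 0) * u (suc m))   ≈⟨ *-cong refl (trans (*-cong (zeroˡ _) refl) (zeroˡ _)) ⟩
        B 0 (suc m) * 0#                         ≈⟨ zeroʳ _ ⟩
        0#                                       ∎
      term : ∀ i j → i ℕ.+ j ≡.≡ m →
        B (suc i) j * ((ιℕ (suc i) * γ (suc i)) * u j) ≈ ιℕ (suc m) * (B i j * (γ (suc i) * u j))
      term i j ≡.refl = begin
          B (suc i) j * ((ιℕ (suc i) * γ (suc i)) * u j)
        ≈⟨ regroup _ _ _ _ ⟩
          (ιℕ (suc i) * B (suc i) j) * (γ (suc i) * u j)
        ≈⟨ *-cong (ιℕ-suc-*-B-sucˡ i j) refl ⟩
          (ιℕ (suc (i ℕ.+ j)) * B i j) * (γ (suc i) * u j)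
        ≈⟨ *-assoc _ _ _ ⟩
          ιℕ (suc (i ℕ.+ j)) * (B i j * (γ (suc i) * u j)) ∎
        where
        regroup : ∀ b n g v → b * ((n * g) * v) ≈ (n * b) * (g * v)
        regroup = solve 4 (λ b n g v → b :* ((n :* g) :* v) := (n :* b) :* (g :* v)) refl

    binomialConv-suc : ∀ m (γ : ℕ → Carrier) z →
      (ιℕ (suc m) + x + z) * binomialConv γ (suc m)
        ≈ γ (suc m) * x + ιℕ (suc m) * binomialConv γ m + binomialConv (λ i → (ιℕ i + z) * γ i) (suc m)
    binomialConv-suc m γ z = begin
        (ιℕ (suc m) + x + z) * binomialConv γ (suc m)
      ≈⟨ convolve-*ˡ (suc m) (ιℕ (suc m) + x + z) (λ i j → B i j * (γ i * u j)) ⟨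
        convolve (suc m) (λ i j → (ιℕ (suc m) + x + z) * (B i j * (γ i * u j)))
      ≈⟨ convolve-cong (suc m) split ⟩
        convolve (suc m) (λ i j → B i j * (γ i * ((ιℕ j + x) * u j)) + B i j * (((ιℕ i + z) * γ i) * u j))
      ≈⟨ convolve-+ (suc m) (λ i j → B i j * (γ i * ((ιℕ j + x) * u j))) (λ i j → B i j * (((ιℕ i + z) * γ i) * u j)) ⟩
        convolve (suc m) (λ i j → B i j * (γ i * ((ιℕ j + x) * u j))) + binomialConv (λ i → (ιℕ i + z) * γ i) (suc m)
      ≈⟨ +-cong (convolve-suc m (λ i j → B i j * (γ i * ((ιℕ j + x) * u j)))) refl ⟩
        convolve m (λ i j → B i (suc j) * (γ i * ((ιℕ (suc j) + x) * u (suc j))))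
          + B (suc m) 0 * (γ (suc m) * ((ιℕ 0 + x) * u 0)) + binomialConv (λ i → (ιℕ i + z) * γ i) (suc m)
      ≈⟨ +-cong (+-cong (convolve-cong m shift) j≡0-term) refl ⟩
        convolve m (λ i j → ιℕ (suc m) * (B i j * (γ i * u j))) + γ (suc m) * x
          + binomialConv (λ i → (ιℕ i + z) * γ i) (suc m)
      ≈⟨ +-cong (trans (+-comm _ _) (+-cong refl (convolve-*ˡ m (ιℕ (suc m)) (λ i j → B i j * (γ i * u j))))) refl ⟩
        γ (suc m) * x + ιℕ (suc m) * binomialConv γ m + binomialConv (λ i → (ιℕ i + z) * γ i) (suc m) ∎
      where
      split : ∀ i j → i ℕ.+ j ≡.≡ suc m → (ιℕ (suc m) + x + z) * (B i j * (γ i * u j))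
            ≈ B i j * (γ i * ((ιℕ j + x) * u j)) + B i j * (((ιℕ i + z) * γ i) * u j)
      split i j i+j≡n = begin
          (ιℕ (suc m) + x + z) * (B i j * (γ i * u j))
        ≈⟨ *-cong (+-cong (+-cong (trans (reflexive (≡.cong ιℕ (≡.sym i+j≡n))) (ιℕ-+ i j)) refl) refl) refl ⟩
          (ιℕ i + ιℕ j + x + z) * (B i j * (γ i * u j))
        ≈⟨ expand (ιℕ i) (ιℕ j) x z (B i j) (γ i) (u j) ⟩
          B i j * (γ i * ((ιℕ j + x) * u j)) + B i j * (((ιℕ i + z) * γ i) * u j) ∎
        where
        expand : ∀ a b x z c g v → (a + b + x + z) * (c * (g * v)) ≈ c * (g * ((b + x) * v)) + c * (((a + z) * g) * v)
        expand = solve 7 (λ a b x z c g v →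
          (a :+ b :+ x :+ z) :* (c :* (g :* v)) := c :* (g :* ((b :+ x) :* v)) :+ c :* (((a :+ z) :* g) :* v)) refl
      shift : ∀ i j → i ℕ.+ j ≡.≡ m →
        B i (suc j) * (γ i * ((ιℕ (suc j) + x) * u (suc j))) ≈ ιℕ (suc m) * (B i j * (γ i * u j))
      shift i j ≡.refl = begin
          B i (suc j) * (γ i * ((ιℕ (suc j) + x) * u (suc j)))
        ≈⟨ *-cong refl (*-cong refl (u-suc j)) ⟩
          B i (suc j) * (γ i * (ιℕ (suc j) * u j))
        ≈⟨ regroup _ _ _ _ ⟩
          (ιℕ (suc j) * B i (suc j)) * (γ i * u j)
        ≈⟨ *-cong (ιℕ-suc-*-B-sucʳ i j) refl ⟩
          (ιℕ (suc (i ℕ.+ j)) * B i j) * (γ i * u j)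
        ≈⟨ *-assoc _ _ _ ⟩
          ιℕ (suc (i ℕ.+ j)) * (B i j * (γ i * u j)) ∎
        where
        regroup : ∀ b g n v → b * (g * (n * v)) ≈ (n * b) * (g * v)
        regroup = solve 4 (λ b g n v → b :* (g :* (n :* v)) := (n :* b) :* (g :* v)) refl
      j≡0-term : B (suc m) 0 * (γ (suc m) * ((ιℕ 0 + x) * u 0)) ≈ γ (suc m) * x
      j≡0-term = begin
        B (suc m) 0 * (γ (suc m) * ((ιℕ 0 + x) * u 0)) ≈⟨ *-cong ι-1 (*-cong refl (*-cong (+-cong ι-0 refl) (Q-diag 0))) ⟩
        1# * (γ (suc m) * ((0# + x) * 1#))             ≈⟨ trans (*-identityˡ _) (*-cong refl (trans (*-identityʳ _) (+-identityˡ x))) ⟩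
        γ (suc m) * x                                  ∎

  module LeftSide {x y} (X : Reciprocals x) (Y : Reciprocals y) where
    open BinomialConvolution X public
    private
      module X = Reciprocals X
      module Y = Reciprocals Y

    β : ℕ → Carrier
    β zero    = 1#
    β (suc m) = Y.alt m

    [ιℕ+y]*β : ∀ i → (ιℕ i + y) * β i ≈ sgn i * y
    [ιℕ+y]*β zero    = trans (trans (*-identityʳ _) (+-cong ι-0 refl))
                               (trans (+-identityˡ y) (sym (trans (*-cong ι-1 refl) (*-identityˡ y))))
    [ιℕ+y]*β (suc m) = Y.alt-correct m

    binomialConv-sgn-suc : ∀ m → (ιℕ (suc m) + x) * binomialConv sgn (suc m) ≈ sgn (suc m) * x
    binomialConv-sgn-suc m = begin
        (ιℕ (suc m) + x) * A (suc m)
      ≈⟨ *-cong (+-identityʳ _) refl ⟨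
        (ιℕ (suc m) + x + 0#) * A (suc m)
      ≈⟨ binomialConv-suc m sgn 0# ⟩
        sgn (suc m) * x + ιℕ (suc m) * A m + binomialConv (λ i → (ιℕ i + 0#) * sgn i) (suc m)
      ≈⟨ +-cong refl (convolve-cong (suc m) {λ i j → B i j * ((ιℕ i + 0#) * sgn i * X.u j)}
                          (λ i j _ → *-cong refl (*-cong (*-cong (+-identityʳ (ιℕ i)) refl) refl))) ⟩
        sgn (suc m) * x + ιℕ (suc m) * A m + binomialConv (λ i → ιℕ i * sgn i) (suc m)
      ≈⟨ +-cong refl (binomialConv-*ιℕ m sgn) ⟩
        sgn (suc m) * x + ιℕ (suc m) * A m + ιℕ (suc m) * binomialConv (λ i → sgn (suc i)) m
      ≈⟨ +-cong refl (*-cong refl sgn-suc-binomialConv) ⟩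
        sgn (suc m) * x + ιℕ (suc m) * A m + ιℕ (suc m) * (- A m)
      ≈⟨ cancel _ _ _ ⟩
        sgn (suc m) * x ∎
      where
      A : ℕ → Carrier
      A = binomialConv sgn
      sgn-suc-binomialConv : binomialConv (λ i → sgn (suc i)) m ≈ - A m
      sgn-suc-binomialConv = trans (convolve-cong m (λ i j _ → trans (*-cong refl (*-cong (ι-neg (signQ i)) refl)) (neg-inside _ _ _)))
                                (convolve-neg m (λ i j → B i j * (sgn i * X.u j)))
        where
        neg-inside : ∀ b s v → b * (- s * v) ≈ - (b * (s * v))
        neg-inside = solve 3 (λ b s v → b :* (:- s :* v) := :- (b :* (s :* v))) refl
      cancel : ∀ a b c → a + b * c + b * (- c) ≈ a
      cancel = solve 3 (λ a b c → a :+ b :* c :+ b :* (:- c) := a) refl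

    binomialConv-sgn-suc≈alt : ∀ m → binomialConv sgn (suc m) ≈ X.alt m
    binomialConv-sgn-suc≈alt m = *-cancelˡ-invertible (X.inv-inverse m) (trans (binomialConv-sgn-suc m) (sym (X.alt-correct m)))

    binomialConv-β-suc : ∀ m → (ιℕ (suc m) + x + y) * binomialConv β (suc m)
                    ≈ ιℕ (suc m) * binomialConv β m + (β (suc m) * x + y * X.alt m)
    binomialConv-β-suc m = begin
        (ιℕ (suc m) + x + y) * binomialConv β (suc m)
      ≈⟨ binomialConv-suc m β y ⟩
        β (suc m) * x + ιℕ (suc m) * binomialConv β m + binomialConv (λ i → (ιℕ i + y) * β i) (suc m)
      ≈⟨ +-cong refl (convolve-cong (suc m) {λ i j → B i j * ((ιℕ i + y) * β i * X.u j)}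
                          (λ i j _ → trans (*-cong refl (*-cong ([ιℕ+y]*β i) refl)) (pull-y (B i j) (sgn i) (X.u j)))) ⟩
        β (suc m) * x + ιℕ (suc m) * binomialConv β m + convolve (suc m) (λ i j → y * (B i j * (sgn i * X.u j)))
      ≈⟨ +-cong refl (trans (convolve-*ˡ (suc m) y (λ i j → B i j * (sgn i * X.u j))) (*-cong refl (binomialConv-sgn-suc≈alt m))) ⟩
        β (suc m) * x + ιℕ (suc m) * binomialConv β m + y * X.alt m
      ≈⟨ rearrange _ _ _ ⟩
        ιℕ (suc m) * binomialConv β m + (β (suc m) * x + y * X.alt m) ∎
      where
      pull-y : ∀ b s v → b * ((s * y) * v) ≈ y * (b * (s * v))
      pull-y b s v = solve 4 (λ b s v y → b :* ((s :* y) :* v) := y :* (b :* (s :* v))) refl b s v y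
      rearrange : ∀ a b c → a + b + c ≈ b + (a + c)
      rearrange = solve 3 (λ a b c → a :+ b :+ c := b :+ (a :+ c)) refl

  module RightSide {x y} (X : Reciprocals x) (Y : Reciprocals y) where
    private
      module X = Reciprocals X
      module Y = Reciprocals Y

    q : ℕ → ℕ → Carrier
    q p k = X.Q k p * Y.Q k p

    rhs : ℕ → Carrier
    rhs n = X.u n * Y.u n - x * y * Σ< n (λ k → ι (weight n k) * q n k)

    private
      ι-*³ : ∀ a b c → ι (a ℚ.* b ℚ.* c) ≈ ι a * ι b * ι c
      ι-*³ a b c = trans (ι-* _ _) (*-cong (ι-* _ _) refl)

    module _ (p : ℕ) where
      private
        ν : Carrier
        ν = ιℕ (suc p)
        a b g : ℕ → Carrier
        a k = ι (weight (suc p) k)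
        b k = ι (weight p k)
        g k = ι (shiftedWeight p k) * q p k
        Σa Σb : Carrier
        Σa = Σ< p (λ k → a k * q p k)
        Σb = Σ< p (λ k → b k * q p k)

      [ν+x][ν+y]*rhs-suc : (ν + x) * (ν + y) * rhs (suc p) ≈ ν * ν * (q p 0 - x * y * (Σa + a p))
      [ν+x][ν+y]*rhs-suc = begin
          (ν + x) * (ν + y) * rhs (suc p)
        ≈⟨ distribute (ν + x) (ν + y) (X.u (suc p)) (Y.u (suc p)) x y _ _ ⟩
          ((ν + x) * X.u (suc p)) * ((ν + y) * Y.u (suc p))
            - x * y * ((ν + x) * (ν + y) * Σ< p (λ k → a k * q (suc p) k) + (ν + x) * (ν + y) * (a p * q (suc p) p))
        ≈⟨ +-cong (*-cong (X.u-suc p) (Y.u-suc p)) (-‿cong (*-cong refl (+-cong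
             (trans (sym (Σ<-*ˡ p _ _)) (Σ<-cong p (λ k _ → q-suc k)))
             (trans (q-suc p) (*-cong refl (*-cong refl q-diag)))))) ⟩
          (ν * X.u p) * (ν * Y.u p) - x * y * (Σ< p (λ k → ν * ν * (a k * q p k)) + ν * ν * (a p * 1#))
        ≈⟨ +-cong refl (-‿cong (*-cong refl (+-cong (Σ<-*ˡ p (ν * ν) _) (*-cong refl (*-identityʳ (a p)))))) ⟩
          (ν * X.u p) * (ν * Y.u p) - x * y * (ν * ν * Σa + ν * ν * a p)
        ≈⟨ factor ν (X.u p) (Y.u p) x y Σa (a p) ⟩
          ν * ν * (q p 0 - x * y * (Σa + a p)) ∎
        where
        distribute : ∀ X Y U V x y A c → X * Y * (U * V - x * y * (A + c))
                   ≈ (X * U) * (Y * V) - x * y * (X * Y * A + X * Y * c)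
        distribute = solve 8 (λ X Y U V x y A c →
          X :* Y :* (U :* V :- x :* y :* (A :+ c)) := (X :* U) :* (Y :* V) :- x :* y :* (X :* Y :* A :+ X :* Y :* c)) refl
        factor : ∀ ν U V x y A c → (ν * U) * (ν * V) - x * y * (ν * ν * A + ν * ν * c) ≈ ν * ν * (U * V - x * y * (A + c))
        factor = solve 7 (λ ν U V x y A c →
          (ν :* U) :* (ν :* V) :- x :* y :* (ν :* ν :* A :+ ν :* ν :* c) := ν :* ν :* (U :* V :- x :* y :* (A :+ c))) refl
        q-diag : q p p ≈ 1#
        q-diag = trans (*-cong (X.Q-diag p) (Y.Q-diag p)) (*-identityʳ 1#)
        q-suc : ∀ k → (ν + x) * (ν + y) * (a k * q (suc p) k) ≈ ν * ν * (a k * q p k)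
        q-suc k = begin
          (ν + x) * (ν + y) * (a k * (X.Q k (suc p) * Y.Q k (suc p))) ≈⟨ regroup (ν + x) (ν + y) (a k) _ _ ⟩
          a k * (((ν + x) * X.Q k (suc p)) * ((ν + y) * Y.Q k (suc p))) ≈⟨ *-cong refl (*-cong (X.Q-sucʳ k p) (Y.Q-sucʳ k p)) ⟩
          a k * ((ν * X.Q k p) * (ν * Y.Q k p))                        ≈⟨ regroup ν ν (a k) _ _ ⟨
          ν * ν * (a k * q p k)                                         ∎
          where
          regroup : ∀ X Y c s t → X * Y * (c * (s * t)) ≈ c * ((X * s) * (Y * t))
          regroup = solve 5 (λ X Y c s t → X :* Y :* (c :* (s :* t)) := c :* ((X :* s) :* (Y :* t))) refl

      private
        telescope-algebra : ∀ {K P x y a b c s s′} →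
          (K + P) * a ≈ P * b → c ≈ - (K * P * b) → K * K * s′ ≈ (K + x) * (K + y) * s →
          ((K + P) * (K + P + x + y) * a - (K + P + x) * (K + P + y) * b) * s ≈ c * s - K * K * b * s′
        telescope-algebra {K} {P} {x} {y} {a} {b} {c} {s} {s′} hyp-a hyp-c hyp-s = begin
            ((K + P) * (K + P + x + y) * a - (K + P + x) * (K + P + y) * b) * s
          ≈⟨ reorder K P x y a b s ⟩
            ((K + P + x + y) * ((K + P) * a) - (K + P + x) * (K + P + y) * b) * s
          ≈⟨ *-cong (+-cong (*-cong refl hyp-a) refl) refl ⟩
            ((K + P + x + y) * (P * b) - (K + P + x) * (K + P + y) * b) * s
          ≈⟨ expand K P x y b s ⟩
            - (K * P * b) * s - b * ((K + x) * (K + y) * s)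
          ≈⟨ +-cong (*-cong (sym hyp-c) refl) (-‿cong (*-cong refl (sym hyp-s))) ⟩
            c * s - b * (K * K * s′)
          ≈⟨ +-cong refl (-‿cong (reassoc b K s′)) ⟩
            c * s - K * K * b * s′ ∎
          where
          reorder : ∀ K P x y a b s → ((K + P) * (K + P + x + y) * a - (K + P + x) * (K + P + y) * b) * s
                  ≈ ((K + P + x + y) * ((K + P) * a) - (K + P + x) * (K + P + y) * b) * s
          reorder = solve 7 (λ K P x y a b s → ((K :+ P) :* (K :+ P :+ x :+ y) :* a :- (K :+ P :+ x) :* (K :+ P :+ y) :* b) :* s
                                            := ((K :+ P :+ x :+ y) :* ((K :+ P) :* a) :- (K :+ P :+ x) :* (K :+ P :+ y) :* b) :* s) refl
          expand : ∀ K P x y b s → ((K + P + x + y) * (P * b) - (K + P + x) * (K + P + y) * b) * s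
                 ≈ - (K * P * b) * s - b * ((K + x) * (K + y) * s)
          expand = solve 6 (λ K P x y b s → ((K :+ P :+ x :+ y) :* (P :* b) :- (K :+ P :+ x) :* (K :+ P :+ y) :* b) :* s
                                         := :- (K :* P :* b) :* s :- b :* ((K :+ x) :* (K :+ y) :* s)) refl
          reassoc : ∀ b K s → b * (K * K * s) ≈ K * K * b * s
          reassoc = solve 3 (λ b K s → b :* (K :* K :* s) := K :* K :* b :* s) refl

      telescope-term : ∀ k → k ℕ.< p → (ν * (ν + x + y) * a k - (ν + x) * (ν + y) * b k) * q p k ≈ g k - g (suc k)
      telescope-term k k<p = begin
          (ν * (ν + x + y) * a k - (ν + x) * (ν + y) * b k) * q p k
        ≈⟨ *-cong (+-cong (*-cong (*-cong ν≈K+P (+-cong (+-cong ν≈K+P refl) refl)) refl)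
                          (-‿cong (*-cong (*-cong (+-cong ν≈K+P refl) (+-cong ν≈K+P refl)) refl))) refl ⟩
          ((K + P) * (K + P + x + y) * a k - (K + P + x) * (K + P + y) * b k) * q p k
        ≈⟨ telescope-algebra hyp-a hyp-c hyp-s ⟩
          ι (shiftedWeight p k) * q p k - K * K * b k * q p (suc k)
        ≈⟨ +-cong refl (-‿cong (*-cong (sym (ι-*³ _ _ _)) refl)) ⟩
          g k - g (suc k) ∎
        where
        K P : Carrier
        K = ιℕ (suc k)
        P = ιℕ (p ∸ k)
        ν≈K+P : ν ≈ K + P
        ν≈K+P = trans (reflexive (≡.cong (λ n → ιℕ (suc n)) (≡.sym (ℕ.m+[n∸m]≡n (ℕ.<⇒≤ k<p))))) (ιℕ-+ (suc k) (p ∸ k))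
        hyp-a : (K + P) * a k ≈ P * b k
        hyp-a = trans (*-cong (sym ν≈K+P) refl) (trans (sym (ι-* _ _)) (trans (reflexive (≡.cong ι (weight-suc k<p))) (ι-* _ _)))
        hyp-c : ι (shiftedWeight p k) ≈ - (K * P * b k)
        hyp-c = trans (reflexive (≡.cong ι (shiftedWeight≡ k<p))) (trans (ι-neg _) (-‿cong (ι-*³ _ _ _)))
        hyp-s : K * K * q p (suc k) ≈ (K + x) * (K + y) * q p k
        hyp-s = trans (regroup K (X.Q (suc k) p) (Y.Q (suc k) p))
                  (trans (*-cong (sym (X.Q-sucˡ k p)) (sym (Y.Q-sucˡ k p))) (regroup′ K x y (X.Q k p) (Y.Q k p)))
          where
          regroup : ∀ K s t → K * K * (s * t) ≈ (K * s) * (K * t)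
          regroup = solve 3 (λ K s t → K :* K :* (s :* t) := (K :* s) :* (K :* t)) refl
          regroup′ : ∀ K x y s t → ((K + x) * s) * ((K + y) * t) ≈ (K + x) * (K + y) * (s * t)
          regroup′ = solve 5 (λ K x y s t → ((K :+ x) :* s) :* ((K :+ y) :* t) := (K :+ x) :* (K :+ y) :* (s :* t)) refl

      weighted-sums-telescope : ν * (ν + x + y) * Σa - (ν + x) * (ν + y) * Σb ≈ - q p 0 + sgn p
      weighted-sums-telescope = begin
          ν * (ν + x + y) * Σa - (ν + x) * (ν + y) * Σb
        ≈⟨ +-cong (Σ<-*ˡ p _ _) (-‿cong (Σ<-*ˡ p _ _)) ⟨
          Σ< p (λ k → ν * (ν + x + y) * (a k * q p k)) - Σ< p (λ k → (ν + x) * (ν + y) * (b k * q p k))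
        ≈⟨ Σ<-- p _ _ ⟨
          Σ< p (λ k → ν * (ν + x + y) * (a k * q p k) - (ν + x) * (ν + y) * (b k * q p k))
        ≈⟨ Σ<-cong p (λ k k<p → trans (collect _ _ _ _ _) (telescope-term k k<p)) ⟩
          Σ< p (λ k → g k - g (suc k))
        ≈⟨ Σ<-telescope p g ⟩
          g 0 - g p
        ≈⟨ +-cong g0 (-‿cong gp) ⟩
          - q p 0 - (- sgn p)
        ≈⟨ solve 2 (λ a b → :- a :- (:- b) := :- a :+ b) refl _ _ ⟩
          - q p 0 + sgn p ∎
        where
        collect : ∀ A B c d s → A * (c * s) - B * (d * s) ≈ (A * c - B * d) * s
        collect = solve 5 (λ A B c d s → A :* (c :* s) :- B :* (d :* s) := (A :* c :- B :* d) :* s) refl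
        g0 : g 0 ≈ - q p 0
        g0 = trans (*-cong (ι-neg 1ℚ) refl) (solve 1 (λ t → :- con 1ℚ :* t := :- t) refl _)
        gp : g p ≈ - sgn p
        gp = trans (*-cong (trans (reflexive (≡.cong ι (shiftedWeight-diag p))) (ι-neg _)) (*-cong (X.Q-diag p) (Y.Q-diag p)))
                   (trans (*-cong refl (*-identityʳ 1#)) (*-identityʳ _))

      ν*ν*a-last : ν * ν * a p ≈ sgn p
      ν*ν*a-last = trans (sym (ι-*³ _ _ _)) (reflexive (≡.cong ι (weight-last p)))

      [ν+x][ν+y]*recurrence : (ν + x) * (ν + y) * (ν * rhs p + (Y.alt p * x + y * X.alt p))
        ≈ ν * ((ν + x) * (ν + y)) * (q p 0 - x * y * Σb) + (- sgn p) * (x * y * ((ν + x) + (ν + y)))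
      [ν+x][ν+y]*recurrence = begin
          (ν + x) * (ν + y) * (ν * rhs p + (Y.alt p * x + y * X.alt p))
        ≈⟨ distribute (ν + x) (ν + y) ν (rhs p) (Y.alt p) x y (X.alt p) ⟩
          ν * ((ν + x) * (ν + y)) * rhs p + (x * (ν + x) * ((ν + y) * Y.alt p) + y * (ν + y) * ((ν + x) * X.alt p))
        ≈⟨ +-cong refl (+-cong (*-cong refl (Y.alt-correct p)) (*-cong refl (X.alt-correct p))) ⟩
          ν * ((ν + x) * (ν + y)) * rhs p + (x * (ν + x) * (sgn (suc p) * y) + y * (ν + y) * (sgn (suc p) * x))
        ≈⟨ +-cong refl (collect x y (ν + x) (ν + y) (sgn (suc p))) ⟩
          ν * ((ν + x) * (ν + y)) * rhs p + sgn (suc p) * (x * y * ((ν + x) + (ν + y)))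
        ≈⟨ +-cong refl (*-cong (ι-neg (signQ p)) refl) ⟩
          ν * ((ν + x) * (ν + y)) * (q p 0 - x * y * Σb) + (- sgn p) * (x * y * ((ν + x) + (ν + y))) ∎
        where
        distribute : ∀ X Y ν r b x y a → X * Y * (ν * r + (b * x + y * a))
                   ≈ ν * (X * Y) * r + (x * X * (Y * b) + y * Y * (X * a))
        distribute = solve 8 (λ X Y ν r b x y a →
          X :* Y :* (ν :* r :+ (b :* x :+ y :* a)) := ν :* (X :* Y) :* r :+ (x :* X :* (Y :* b) :+ y :* Y :* (X :* a))) refl
        collect : ∀ x y X Y s → x * X * (s * y) + y * Y * (s * x) ≈ s * (x * y * (X + Y))
        collect = solve 5 (λ x y X Y s → x :* X :* (s :* y) :+ y :* Y :* (s :* x) := s :* (x :* y :* (X :+ Y))) refl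

      private
        combine : ∀ {ν x y q₀ A B c s} → ν * (ν + x + y) * A - (ν + x) * (ν + y) * B ≈ - q₀ + s → ν * ν * c ≈ s →
          (ν + x + y) * (ν * ν * (q₀ - x * y * (A + c)))
            ≈ ν * ((ν + x) * (ν + y)) * (q₀ - x * y * B) + (- s) * (x * y * ((ν + x) + (ν + y)))
        combine {ν} {x} {y} {q₀} {A} {B} {c} {s} hyp₁ hyp₂ = begin
            (ν + x + y) * (ν * ν * (q₀ - x * y * (A + c)))
          ≈⟨ expand ν x y q₀ A B c s ⟩
            ν * ((ν + x) * (ν + y)) * (q₀ - x * y * B) + (- s) * (x * y * ((ν + x) + (ν + y)))
              - x * y * (ν * ((ν * (ν + x + y) * A - (ν + x) * (ν + y) * B) - (- q₀ + s)) + (ν + x + y) * (ν * ν * c - s))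
          ≈⟨ +-cong refl (-‿cong (*-cong refl (+-cong (*-cong refl (≈⇒-≈0 hyp₁)) (*-cong refl (≈⇒-≈0 hyp₂))))) ⟩
            ν * ((ν + x) * (ν + y)) * (q₀ - x * y * B) + (- s) * (x * y * ((ν + x) + (ν + y)))
              - x * y * (ν * 0# + (ν + x + y) * 0#)
          ≈⟨ +-cong refl (-‿cong (trans (*-cong refl (trans (+-cong (zeroʳ ν) (zeroʳ _)) (+-identityʳ 0#))) (zeroʳ _))) ⟩
            ν * ((ν + x) * (ν + y)) * (q₀ - x * y * B) + (- s) * (x * y * ((ν + x) + (ν + y))) - 0#
          ≈⟨ trans (+-cong refl -0#≈0#) (+-identityʳ _) ⟩
            ν * ((ν + x) * (ν + y)) * (q₀ - x * y * B) + (- s) * (x * y * ((ν + x) + (ν + y))) ∎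
          where
          ≈⇒-≈0 : ∀ {d e} → d ≈ e → d - e ≈ 0#
          ≈⇒-≈0 {d} {e} d≈e = trans (+-cong d≈e refl) (-‿inverseʳ e)
          expand : ∀ ν x y q₀ A B c s → (ν + x + y) * (ν * ν * (q₀ - x * y * (A + c)))
                 ≈ ν * ((ν + x) * (ν + y)) * (q₀ - x * y * B) + (- s) * (x * y * ((ν + x) + (ν + y)))
                   - x * y * (ν * ((ν * (ν + x + y) * A - (ν + x) * (ν + y) * B) - (- q₀ + s)) + (ν + x + y) * (ν * ν * c - s))
          expand = solve 8 (λ ν x y q₀ A B c s → (ν :+ x :+ y) :* (ν :* ν :* (q₀ :- x :* y :* (A :+ c)))
            := ν :* ((ν :+ x) :* (ν :+ y)) :* (q₀ :- x :* y :* B) :+ (:- s) :* (x :* y :* ((ν :+ x) :+ (ν :+ y)))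
               :- x :* y :* (ν :* ((ν :* (ν :+ x :+ y) :* A :- (ν :+ x) :* (ν :+ y) :* B) :- (:- q₀ :+ s))
                             :+ (ν :+ x :+ y) :* (ν :* ν :* c :- s))) refl

      rhs-suc : (ν + x + y) * rhs (suc p) ≈ ν * rhs p + (Y.alt p * x + y * X.alt p)
      rhs-suc = *-cancelˡ-invertible inverse (begin
          (ν + x) * (ν + y) * ((ν + x + y) * rhs (suc p))
        ≈⟨ swap ((ν + x) * (ν + y)) (ν + x + y) (rhs (suc p)) ⟩
          (ν + x + y) * ((ν + x) * (ν + y) * rhs (suc p))
        ≈⟨ *-cong refl [ν+x][ν+y]*rhs-suc ⟩
          (ν + x + y) * (ν * ν * (q p 0 - x * y * (Σa + a p)))
        ≈⟨ combine weighted-sums-telescope ν*ν*a-last ⟩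
          ν * ((ν + x) * (ν + y)) * (q p 0 - x * y * Σb) + (- sgn p) * (x * y * ((ν + x) + (ν + y)))
        ≈⟨ [ν+x][ν+y]*recurrence ⟨
          (ν + x) * (ν + y) * (ν * rhs p + (Y.alt p * x + y * X.alt p)) ∎)
        where
        swap : ∀ a b c → a * (b * c) ≈ b * (a * c)
        swap = solve 3 (λ a b c → a :* (b :* c) := b :* (a :* c)) refl
        inverse : (ν + x) * (ν + y) * (X.inv p * Y.inv p) ≈ 1#
        inverse = trans (regroup (ν + x) (ν + y) (X.inv p) (Y.inv p))
                    (trans (*-cong (X.inv-inverse p) (Y.inv-inverse p)) (*-identityʳ 1#))
          where
          regroup : ∀ a b c d → a * b * (c * d) ≈ (a * c) * (b * d)
          regroup = solve 4 (λ a b c d → a :* b :* (c :* d) := (a :* c) :* (b :* d)) refl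

  module Identity {x y} (X : Reciprocals x) (Y : Reciprocals y) (x³≈0 : x * x * x ≈ 0#) where
    open LeftSide X Y
    open RightSide X Y
    private
      module X = Reciprocals X
      module Y = Reciprocals Y

    -- The inverse is ν / ((ν + x)(ν + y)) (1 + w + w²) with w = x y / ((ν + x)(ν + y)):
    -- the geometric series in w stops because w³ = 0.
    [ν+x+y]⁻¹ : ℕ → Carrier
    [ν+x+y]⁻¹ m = ιℕ (suc m) * (X.inv m * Y.inv m) * (ι 1ℚ + w + w * w)
      where w = x * y * (X.inv m * Y.inv m)

    [ν+x+y]⁻¹-inverse : ∀ m → (ιℕ (suc m) + x + y) * [ν+x+y]⁻¹ m ≈ 1#
    [ν+x+y]⁻¹-inverse m = begin
        (ν + x + y) * (ν * (a * b) * (ι 1ℚ + w + w * w))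
      ≈⟨ expand ν x y a b ⟩
        ((ν + x) * a) * ((ν + y) * b) * (ι 1ℚ + w + w * w) - w * (ι 1ℚ + w + w * w)
      ≈⟨ +-cong (*-cong (*-cong (X.inv-inverse m) (Y.inv-inverse m)) refl) refl ⟩
        1# * 1# * (ι 1ℚ + w + w * w) - w * (ι 1ℚ + w + w * w)
      ≈⟨ +-cong (trans (*-cong (*-identityˡ 1#) refl) (*-identityˡ _)) refl ⟩
        (ι 1ℚ + w + w * w) - w * (ι 1ℚ + w + w * w)
      ≈⟨ geometric x y a b ⟩
        ι 1ℚ - (x * x * x) * ((y * (a * b)) * (y * (a * b)) * (y * (a * b)))
      ≈⟨ +-cong ι-1 (-‿cong (trans (*-cong x³≈0 refl) (zeroˡ _))) ⟩
        1# - 0#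
      ≈⟨ trans (+-cong refl -0#≈0#) (+-identityʳ 1#) ⟩
        1# ∎
      where
      ν a b w : Carrier
      ν = ιℕ (suc m)
      a = X.inv m
      b = Y.inv m
      w = x * y * (a * b)
      expand : ∀ ν x y a b → (ν + x + y) * (ν * (a * b) * (ι 1ℚ + x * y * (a * b) + x * y * (a * b) * (x * y * (a * b))))
             ≈ ((ν + x) * a) * ((ν + y) * b) * (ι 1ℚ + x * y * (a * b) + x * y * (a * b) * (x * y * (a * b)))
               - x * y * (a * b) * (ι 1ℚ + x * y * (a * b) + x * y * (a * b) * (x * y * (a * b)))
      expand = solve 5 (λ ν x y a b →
        (ν :+ x :+ y) :* (ν :* (a :* b) :* (con 1ℚ :+ x :* y :* (a :* b) :+ x :* y :* (a :* b) :* (x :* y :* (a :* b))))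
          := ((ν :+ x) :* a) :* ((ν :+ y) :* b) :* (con 1ℚ :+ x :* y :* (a :* b) :+ x :* y :* (a :* b) :* (x :* y :* (a :* b)))
             :- x :* y :* (a :* b) :* (con 1ℚ :+ x :* y :* (a :* b) :+ x :* y :* (a :* b) :* (x :* y :* (a :* b)))) refl
      geometric : ∀ x y a b → (ι 1ℚ + x * y * (a * b) + x * y * (a * b) * (x * y * (a * b)))
                  - x * y * (a * b) * (ι 1ℚ + x * y * (a * b) + x * y * (a * b) * (x * y * (a * b)))
                ≈ ι 1ℚ - (x * x * x) * ((y * (a * b)) * (y * (a * b)) * (y * (a * b)))
      geometric = solve 4 (λ x y a b →
        (con 1ℚ :+ x :* y :* (a :* b) :+ x :* y :* (a :* b) :* (x :* y :* (a :* b)))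
          :- x :* y :* (a :* b) :* (con 1ℚ :+ x :* y :* (a :* b) :+ x :* y :* (a :* b) :* (x :* y :* (a :* b)))
          := con 1ℚ :- (x :* x :* x) :* ((y :* (a :* b)) :* (y :* (a :* b)) :* (y :* (a :* b)))) refl

    binomialConv-β≈rhs : ∀ n → binomialConv β n ≈ rhs n
    binomialConv-β≈rhs zero    = begin
      B 0 0 * (1# * X.u 0)          ≈⟨ *-cong ι-1 (*-identityˡ _) ⟩
      1# * X.u 0                    ≈⟨ *-identityˡ _ ⟩
      X.u 0                         ≈⟨ *-identityʳ _ ⟨
      X.u 0 * 1#                    ≈⟨ *-cong refl (Y.Q-diag 0) ⟨
      X.u 0 * Y.u 0                 ≈⟨ +-identityʳ _ ⟨
      X.u 0 * Y.u 0 + 0#            ≈⟨ +-cong refl (trans (-‿cong (zeroʳ _)) -0#≈0#) ⟨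
      X.u 0 * Y.u 0 - x * y * 0#    ∎
    binomialConv-β≈rhs (suc p) = *-cancelˡ-invertible ([ν+x+y]⁻¹-inverse p) (begin
      (ν + x + y) * binomialConv β (suc p)                           ≈⟨ binomialConv-β-suc p ⟩
      ν * binomialConv β p + (β (suc p) * x + y * X.alt p)           ≈⟨ +-cong (*-cong refl (binomialConv-β≈rhs p)) refl ⟩
      ν * rhs p + (Y.alt p * x + y * X.alt p)                     ≈⟨ rhs-suc p ⟨
      (ν + x + y) * rhs (suc p)                                   ∎)
      where
      ν : Carrier
      ν = ιℕ (suc p)

module Transport {c₁ ℓ₁ c₂ ℓ₂} (S : CommutativeRing c₁ ℓ₁) (R : CommutativeRing c₂ ℓ₂)
  {ιS : ℚ → CommutativeRing.Carrier S} (ιS-hom : IsRingHomomorphism ℚ.+-*-rawRing (CommutativeRing.rawRing S) ιS)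
  {ιR : ℚ → CommutativeRing.Carrier R} (ιR-hom : IsRingHomomorphism ℚ.+-*-rawRing (CommutativeRing.rawRing R) ιR)
  {φ : CommutativeRing.Carrier S → CommutativeRing.Carrier R}
  (φ-hom : IsRingHomomorphism (CommutativeRing.rawRing S) (CommutativeRing.rawRing R) φ)
  (φ∘ιS≈ιR : ∀ q → CommutativeRing._≈_ R (φ (ιS q)) (ιR q)) where

  private
    module S = Recurrences S ιS-hom
    module R = Recurrences R ιR-hom
  open CommutativeRing R
  open IsRingHomomorphism φ-hom using (⟦⟧-cong; +-homo; *-homo; 1#-homo)

  map-Reciprocals : ∀ {z} → S.Reciprocals z → R.Reciprocals (φ z)
  map-Reciprocals {z} Z = record
    { inv         = λ m → φ (Z.inv m)
    ; inv-inverse = λ m → trans (sym (φ-linear (suc m) (Z.inv m))) (trans (⟦⟧-cong (Z.inv-inverse m)) 1#-homo)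
    ; Q           = λ k p → φ (Z.Q k p)
    ; Q-diag      = λ p → trans (⟦⟧-cong (Z.Q-diag p)) 1#-homo
    ; Q-sucˡ      = λ k p → trans (sym (φ-linear (suc k) (Z.Q k p))) (trans (⟦⟧-cong (Z.Q-sucˡ k p)) (φ-scale (suc k) _))
    ; Q-sucʳ      = λ k p → trans (sym (φ-linear (suc p) (Z.Q k (suc p)))) (trans (⟦⟧-cong (Z.Q-sucʳ k p)) (φ-scale (suc p) _))
    }
    where
    module Z = S.Reciprocals Z
    φ-scale : ∀ n a → φ (CommutativeRing._*_ S (S.ιℕ n) a) ≈ R.ιℕ n * φ a
    φ-scale n a = trans (*-homo _ _) (*-cong (φ∘ιS≈ιR _) refl)
    φ-linear : ∀ n a → φ (CommutativeRing._*_ S (CommutativeRing._+_ S (S.ιℕ n) z) a) ≈ (R.ιℕ n + φ z) * φ a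
    φ-linear n a = trans (*-homo _ _) (*-cong (trans (+-homo _ _) (+-cong (φ∘ιS≈ιR _) refl)) refl)

module ℚ[ε] = Truncated ℚ.+-*-commutativeRing
module ℚ[ε]-Recurrences = Recurrences ℚ[ε].⊕-⊗-commutativeRing ℚ[ε].const-isRingHomomorphism

module HarmonicExpansion where
  open import Data.Rational using (½; _+_; _*_; _-_; -_)
  open import Relation.Binary.PropositionalEquality
  open import Tactic.RingSolver using (solve-∀)
  open ℚ[ε] using (Trunc; ⟨_,_,_⟩; ≋⟨_,_,_⟩; _≋_; _⊕_; _⊗_; const; ε; 𝟙)

  -- The expansion of the product of j / (j + ε) over a range of j with Σ 1/j = d and Σ 1/j² = e.
  expansion : ℚ → ℚ → Trunc
  expansion d e = ⟨ 1ℚ , - d , (d * d + e) * ½ ⟩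

  reciprocal : ℚ → Trunc
  reciprocal t = ⟨ t , - (t * t) , t * t * t ⟩

  private
    -- Each coordinate identity below holds up to a multiple of 1 - n t.
    vanishes : ∀ n t → n * t ≡ 1ℚ → ∀ a k → a + (1ℚ - n * t) * k ≡ a
    vanishes n t n*t≡1 a k = trans (cong (λ s → a + (1ℚ - s) * k) n*t≡1) (vanish a k)
      where
      vanish : ∀ a k → a + (1ℚ - 1ℚ) * k ≡ a
      vanish = solve-∀ ℚ-ring

  [n+ε]*reciprocal : ∀ n t → n * t ≡ 1ℚ → (const n ⊕ ε) ⊗ reciprocal t ≋ 𝟙
  [n+ε]*reciprocal n t n*t≡1 = ≋⟨ trans (c₀ n t) (vanishes n t n*t≡1 _ (- 1ℚ))
                                , trans (c₁ n t) (vanishes n t n*t≡1 _ t)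
                                , trans (c₂ n t) (vanishes n t n*t≡1 _ (- (t * t))) ⟩
    where
    c₀ : ∀ n t → (n + 0ℚ) * t ≡ 1ℚ + (1ℚ - n * t) * (- 1ℚ)
    c₀ = solve-∀ ℚ-ring
    c₁ : ∀ n t → (n + 0ℚ) * (- (t * t)) + (0ℚ + 1ℚ) * t ≡ 0ℚ + (1ℚ - n * t) * t
    c₁ = solve-∀ ℚ-ring
    c₂ : ∀ n t → (n + 0ℚ) * (t * t * t) + (0ℚ + 1ℚ) * (- (t * t)) + (0ℚ + 0ℚ) * t ≡ 0ℚ + (1ℚ - n * t) * (- (t * t))
    c₂ = solve-∀ ℚ-ring

  [n+ε]*expansion : ∀ n t d e {d′ e′} → n * t ≡ 1ℚ → d′ ≡ d + t → e′ ≡ e + t * t →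
                    (const n ⊕ ε) ⊗ expansion d′ e′ ≋ const n ⊗ expansion d e
  [n+ε]*expansion n t d e n*t≡1 refl refl =
    ≋⟨ c₀ n
     , trans (c₁ n t d) (vanishes n t n*t≡1 _ 1ℚ)
     , trans (c₂ n t d e) (vanishes n t n*t≡1 _ (- (d + t))) ⟩
    where
    c₀ : ∀ n → (n + 0ℚ) * 1ℚ ≡ n * 1ℚ
    c₀ = solve-∀ ℚ-ring
    c₁ : ∀ n t d → (n + 0ℚ) * (- (d + t)) + (0ℚ + 1ℚ) * 1ℚ ≡ (n * (- d) + 0ℚ * 1ℚ) + (1ℚ - n * t) * 1ℚ
    c₁ = solve-∀ ℚ-ring
    c₂ : ∀ n t d e → (n + 0ℚ) * (((d + t) * (d + t) + (e + t * t)) * ½) + (0ℚ + 1ℚ) * (- (d + t)) + (0ℚ + 0ℚ) * 1ℚ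
                   ≡ (n * ((d * d + e) * ½) + 0ℚ * (- d) + 0ℚ * 1ℚ) + (1ℚ - n * t) * (- (d + t))
    c₂ = solve-∀ ℚ-ring

  harmonicExpansion : ℕ → ℕ → Trunc
  harmonicExpansion k p = expansion (H p - H k) (H^ 2 p - H^ 2 k)

  harmonicReciprocals : ℚ[ε]-Recurrences.Reciprocals ε
  harmonicReciprocals = record
    { inv         = λ m → reciprocal (invℕ (suc m))
    ; inv-inverse = λ m → [n+ε]*reciprocal (ℕtoℚ (suc m)) (invℕ (suc m)) (ℕtoℚ*invℕ≡1 m)
    ; Q           = harmonicExpansion
    ; Q-diag      = λ p → ≋⟨ refl , -[a-a]≡0 (H p) , diag₂ (H p) (H^ 2 p) ⟩
    ; Q-sucˡ      = λ k p → [n+ε]*expansion (ℕtoℚ (suc k)) (invℕ (suc k))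
        (H p - H (suc k)) (H^ 2 p - H^ 2 (suc k)) (ℕtoℚ*invℕ≡1 k)
        (trans (shift (H p) (H k) _) (cong (λ h → (H p - h) + invℕ (suc k)) (sym (H-suc k))))
        (trans (shift (H^ 2 p) (H^ 2 k) _) (cong (λ h → (H^ 2 p - h) + invℕ (suc k) * invℕ (suc k)) (sym (H²-suc k))))
    ; Q-sucʳ      = λ k p → [n+ε]*expansion (ℕtoℚ (suc p)) (invℕ (suc p))
        (H p - H k) (H^ 2 p - H^ 2 k) (ℕtoℚ*invℕ≡1 p)
        (trans (cong (_- H k) (H-suc p)) (reorder (H p) (H k) _))
        (trans (cong (_- H^ 2 k) (H²-suc p)) (reorder (H^ 2 p) (H^ 2 k) _))
    }
    where
    -[a-a]≡0 : ∀ a → - (a - a) ≡ 0ℚ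
    -[a-a]≡0 = solve-∀ ℚ-ring
    diag₂ : ∀ a b → ((a - a) * (a - a) + (b - b)) * ½ ≡ 0ℚ
    diag₂ = solve-∀ ℚ-ring
    shift : ∀ a b t → a - b ≡ (a - (b + t)) + t
    shift = solve-∀ ℚ-ring
    reorder : ∀ a b t → (a + t) - b ≡ (a - b) + t
    reorder = solve-∀ ℚ-ring

open import Data.Rational using (½; _+_; _*_; _-_; -_)
open import Data.Rational.Properties using (+-identityˡ; +-identityʳ; *-zeroʳ)
open import Relation.Binary.PropositionalEquality
open import Tactic.RingSolver using (solve-∀)
open HarmonicExpansion using (reciprocal; harmonicExpansion; harmonicReciprocals)

open ℚ[ε] using (Trunc; c₀; c₁; c₂; ε; const)

-- In ℚ[ε][δ]/(δ³) the inner variable ε plays the role of x and the outer variable δ that of y.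
module ℚ[x,y] = Truncated ℚ[ε].⊕-⊗-commutativeRing
open ℚ[x,y] using (_≋_; _⊗_)

private
  module ℚ[ε]-ring = CommutativeRing ℚ[ε].⊕-⊗-commutativeRing
  module ℚ[x,y]-ring = CommutativeRing ℚ[x,y].⊕-⊗-commutativeRing

X : Trunc → ℚ[x,y].Trunc
X = ℚ[x,y].const

open TruncatedMap ℚ.+-*-commutativeRing ℚ[ε].⊕-⊗-commutativeRing ℚ[ε].const-isRingHomomorphism
  renaming (map to Y; map-isRingHomomorphism to Y-isRingHomomorphism)

ι : ℚ → ℚ[x,y].Trunc
ι q = X (const q)

ι-isRingHomomorphism : IsRingHomomorphism ℚ.+-*-rawRing ℚ[x,y]-ring.rawRing ι
ι-isRingHomomorphism = isRingHomomorphism ℚ[x,y].≋-trans ℚ[ε].const-isRingHomomorphism ℚ[x,y].const-isRingHomomorphism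

module ℚ[x,y]-Recurrences = Recurrences ℚ[x,y].⊕-⊗-commutativeRing ι-isRingHomomorphism

private
  module ℚ[ε]⟶ℚ[x,y] = Transport ℚ[ε].⊕-⊗-commutativeRing ℚ[x,y].⊕-⊗-commutativeRing
                                 ℚ[ε].const-isRingHomomorphism ι-isRingHomomorphism

harmonicˣ : ℚ[x,y]-Recurrences.Reciprocals (X ε)
harmonicˣ = ℚ[ε]⟶ℚ[x,y].map-Reciprocals ℚ[x,y].const-isRingHomomorphism (λ _ → ℚ[x,y].≋-refl) harmonicReciprocals

harmonicʸ : ℚ[x,y]-Recurrences.Reciprocals (Y ε)
harmonicʸ = ℚ[ε]⟶ℚ[x,y].map-Reciprocals Y-isRingHomomorphism (λ _ → ℚ[x,y].≋-refl) harmonicReciprocals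

x³≈0 : X ε ⊗ X ε ⊗ X ε ≋ ℚ[x,y].𝟘
x³≈0 = ℚ[x,y].≋-refl

open ℚ[x,y]-Recurrences.Identity harmonicˣ harmonicʸ x³≈0 using (binomialConv-β≈rhs)

private
  module Left = ℚ[x,y]-Recurrences.LeftSide harmonicˣ harmonicʸ
  module Right = ℚ[x,y]-Recurrences.RightSide harmonicˣ harmonicʸ
  open ℚ[x,y]-Recurrences using (convolve; Σ<; B)
  module Y = IsRingHomomorphism Y-isRingHomomorphism

[x²y²] [xy] : ℚ[x,y].Trunc → ℚ
[x²y²] t = c₂ (ℚ[x,y].c₂ t)
[xy]   t = c₁ (ℚ[x,y].c₁ t)

[x²y²]-cong : ∀ {s t} → s ≋ t → [x²y²] s ≡ [x²y²] t
[x²y²]-cong s≋t = ℚ[ε].c₂-≈ (ℚ[x,y].c₂-≈ s≋t)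

[x²y²]-ι-⊗ : ∀ q t → [x²y²] (ι q ⊗ t) ≡ q * [x²y²] t
[x²y²]-ι-⊗ q t = trans (ℚ[ε].c₂-≈ (ℚ[x,y].c₂-const-⊗ (const q) t)) (ℚ[ε].c₂-const-⊗ q (ℚ[x,y].c₂ t))

[xy]-ι-⊗ : ∀ q t → [xy] (ι q ⊗ t) ≡ q * [xy] t
[xy]-ι-⊗ q t = trans (ℚ[ε].c₁-≈ (ℚ[x,y].c₁-const-⊗ (const q) t)) (ℚ[ε].c₁-const-⊗ q (ℚ[x,y].c₁ t))

[x²y²]-Y-⊗-X : ∀ b a → [x²y²] (Y b ⊗ X a) ≡ c₂ b * c₂ a
[x²y²]-Y-⊗-X b a = trans (ℚ[ε].c₂-≈ (ℚ[x,y].c₂-⊗-const (Y b) a)) (ℚ[ε].c₂-const-⊗ (c₂ b) a)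

[xy]-X-⊗-Y : ∀ a b → [xy] (X a ⊗ Y b) ≡ c₁ a * c₁ b
[xy]-X-⊗-Y a b = trans (ℚ[ε].c₁-≈ (ℚ[x,y].c₁-const-⊗ a (Y b))) (ℚ[ε].c₁-⊗-const a (c₁ b))

[x²y²]-xy-⊗ : ∀ s → [x²y²] (X ε ⊗ Y ε ⊗ s) ≡ [xy] s
[x²y²]-xy-⊗ s = trans ([x²y²]-cong (ℚ[x,y]-ring.*-assoc (X ε) (Y ε) s))
  (trans (ℚ[ε].c₂-≈ (ℚ[x,y].c₂-const-⊗ ε (Y ε ⊗ s)))
    (trans (ℚ[ε].c₂-≈ (ℚ[ε]-ring.*-cong (ℚ[ε].≋-refl {ε}) (ℚ[x,y].c₂-ε-⊗ s))) (ℚ[ε].c₂-ε-⊗ (ℚ[x,y].c₁ s))))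

[x²y²]-convolve : ∀ n f → [x²y²] (convolve n f) ≡ [x²y²] (f 0 n) + sumFrom1 n (λ k → [x²y²] (f k (n ∸ k)))
[x²y²]-convolve zero    f = sym (+-identityʳ _)
[x²y²]-convolve (suc n) f = cong ([x²y²] (f 0 (suc n)) +_)
  (trans ([x²y²]-convolve n (λ i j → f (suc i) j)) (sym (sumFrom1-suc n (λ k → [x²y²] (f k (suc n ∸ k))))))

c₂-alternating : ∀ s t → c₂ (const s ℚ[ε].⊗ ε ℚ[ε].⊗ reciprocal t) ≡ s * - (t * t)
c₂-alternating s t = trans (ℚ[ε].c₂-≈ (ℚ[ε]-ring.*-assoc (const s) ε (reciprocal t)))
  (trans (ℚ[ε].c₂-const-⊗ s (ε ℚ[ε].⊗ reciprocal t)) (cong (s *_) (ℚ[ε].c₂-ε-⊗ (reciprocal t))))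

[x²y²]-binomialConv-β : ∀ n → [x²y²] (Left.binomialConv Left.β n)
  ≡ ½ * sumFrom1 n (λ k → signQ (k ∸ 1) * invℕ (k ℕ.* k) * ℕtoℚ (n C k) * (H (n ∸ k) * H (n ∸ k) + H^ 2 (n ∸ k)))
[x²y²]-binomialConv-β n = begin
    [x²y²] (convolve n term)
  ≡⟨ [x²y²]-convolve n term ⟩
    [x²y²] (term 0 n) + sumFrom1 n (λ k → [x²y²] (term k (n ∸ k)))
  ≡⟨ cong₂ _+_ term-zero (sumFrom1-cong n term-suc) ⟩
    0ℚ + sumFrom1 n (λ k → ½ * (signQ (k ∸ 1) * invℕ (k ℕ.* k) * ℕtoℚ (n C k) * (H (n ∸ k) * H (n ∸ k) + H^ 2 (n ∸ k))))
  ≡⟨ trans (+-identityˡ _) (sumFrom1-*ˡ n ½ _) ⟩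
    ½ * sumFrom1 n (λ k → signQ (k ∸ 1) * invℕ (k ℕ.* k) * ℕtoℚ (n C k) * (H (n ∸ k) * H (n ∸ k) + H^ 2 (n ∸ k))) ∎
  where
  open ≡-Reasoning
  term : ℕ → ℕ → ℚ[x,y].Trunc
  term i j = B i j ⊗ (Left.β i ⊗ X (harmonicExpansion 0 j))
  term-zero : [x²y²] (term 0 n) ≡ 0ℚ
  term-zero = trans ([x²y²]-ι-⊗ 1ℚ (ℚ[x,y].𝟙 ⊗ X (harmonicExpansion 0 n)))
    (trans (cong (1ℚ *_) ([x²y²]-cong (ℚ[x,y]-ring.*-identityˡ (X (harmonicExpansion 0 n))))) (*-zeroʳ 1ℚ))
  term-suc : ∀ m → m ℕ.< n → [x²y²] (term (suc m) (n ∸ suc m))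
           ≡ ½ * (signQ m * invℕ (suc m ℕ.* suc m) * ℕtoℚ (n C suc m) * (H (n ∸ suc m) * H (n ∸ suc m) + H^ 2 (n ∸ suc m)))
  term-suc m m<n = begin
      [x²y²] (B (suc m) j ⊗ (Left.β (suc m) ⊗ X a))
    ≡⟨ [x²y²]-ι-⊗ (ℕtoℚ (binom (suc m) j)) (Left.β (suc m) ⊗ X a) ⟩
      ℕtoℚ (binom (suc m) j) * [x²y²] (Left.β (suc m) ⊗ X a)
    ≡⟨ cong (ℕtoℚ (binom (suc m) j) *_)
         (trans ([x²y²]-cong (ℚ[x,y]-ring.*-cong β≋Y ℚ[x,y]-ring.refl)) ([x²y²]-Y-⊗-X b a)) ⟩
      ℕtoℚ (binom (suc m) j) * (c₂ b * c₂ a)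
    ≡⟨ cong (λ c → ℕtoℚ (binom (suc m) j) * (c * c₂ a)) (c₂-alternating (signQ (suc m)) t) ⟩
      ℕtoℚ (binom (suc m) j) * ((- signQ m * - (t * t)) * (((H j - 0ℚ) * (H j - 0ℚ) + (H^ 2 j - 0ℚ)) * ½))
    ≡⟨ rearrange (ℕtoℚ (binom (suc m) j)) (signQ m) (t * t) (H j) (H^ 2 j) ⟩
      ½ * (signQ m * (t * t) * ℕtoℚ (binom (suc m) j) * (H j * H j + H^ 2 j))
    ≡⟨ cong₂ (λ s c → ½ * (signQ m * s * ℕtoℚ c * (H j * H j + H^ 2 j)))
             (sym (invℕ-* (suc m) (suc m))) (sym (nCk≡binom m<n)) ⟩
      ½ * (signQ m * invℕ (suc m ℕ.* suc m) * ℕtoℚ (n C suc m) * (H j * H j + H^ 2 j)) ∎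
    where
    j : ℕ
    j = n ∸ suc m
    t : ℚ
    t = invℕ (suc m)
    a b : Trunc
    a = harmonicExpansion 0 j
    b = const (signQ (suc m)) ℚ[ε].⊗ ε ℚ[ε].⊗ reciprocal t
    β≋Y : Left.β (suc m) ≋ Y b
    β≋Y = ℚ[x,y]-ring.sym (ℚ[x,y]-ring.trans (Y.*-homo (const (signQ (suc m)) ℚ[ε].⊗ ε) (reciprocal t))
      (ℚ[x,y]-ring.*-cong (Y.*-homo (const (signQ (suc m))) ε) ℚ[x,y]-ring.refl))
    rearrange : ∀ c s τ h e → c * ((- s * - τ) * (((h - 0ℚ) * (h - 0ℚ) + (e - 0ℚ)) * ½)) ≡ ½ * (s * τ * c * (h * h + e))
    rearrange = solve-∀ ℚ-ring

[xy]-Σ< : ∀ n f → [xy] (Σ< n f) ≡ sumBelow n (λ k → [xy] (f k))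
[xy]-Σ< zero    f = refl
[xy]-Σ< (suc n) f = cong (_+ [xy] (f n)) ([xy]-Σ< n f)

[x²y²]-rhs : ∀ n → [x²y²] (Right.rhs n)
  ≡ (H n * H n + H^ 2 n) * ½ * ((H n * H n + H^ 2 n) * ½)
    - sumBelow n (λ k → signQ k * ((H n - H k) * (H n - H k)) * invℕ (suc k ℕ.* (n ∸ k) ℕ.* (n C k)))
[x²y²]-rhs n = begin
    [x²y²] (X a ⊗ Y a) - [x²y²] (X ε ⊗ Y ε ⊗ Σ< n summand)
  ≡⟨ cong₂ _-_ (trans ([x²y²]-cong (ℚ[x,y]-ring.*-comm (X a) (Y a))) ([x²y²]-Y-⊗-X a a))
               (trans ([x²y²]-xy-⊗ (Σ< n summand)) ([xy]-Σ< n summand)) ⟩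
    c₂ a * c₂ a - sumBelow n (λ k → [xy] (summand k))
  ≡⟨ cong₂ (λ h s → h * h - s) (hh (H n) (H^ 2 n)) (sumBelow-cong n coefficient) ⟩
    (H n * H n + H^ 2 n) * ½ * ((H n * H n + H^ 2 n) * ½)
      - sumBelow n (λ k → signQ k * ((H n - H k) * (H n - H k)) * invℕ (suc k ℕ.* (n ∸ k) ℕ.* (n C k))) ∎
  where
  open ≡-Reasoning
  a : Trunc
  a = harmonicExpansion 0 n
  summand : ℕ → ℚ[x,y].Trunc
  summand k = ι (weight n k) ⊗ Right.q n k
  hh : ∀ h e → ((h - 0ℚ) * (h - 0ℚ) + (e - 0ℚ)) * ½ ≡ (h * h + e) * ½
  hh = solve-∀ ℚ-ring
  coefficient : ∀ k → [xy] (summand k) ≡ signQ k * ((H n - H k) * (H n - H k)) * invℕ (suc k ℕ.* (n ∸ k) ℕ.* (n C k))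
  coefficient k = trans ([xy]-ι-⊗ (weight n k) (Right.q n k))
    (trans (cong (weight n k *_) ([xy]-X-⊗-Y (harmonicExpansion k n) (harmonicExpansion k n)))
      (rearrange (signQ k) (invℕ (suc k ℕ.* (n ∸ k) ℕ.* (n C k))) (H n - H k)))
    where
    rearrange : ∀ s i d → s * i * ((- d) * (- d)) ≡ s * (d * d) * i
    rearrange = solve-∀ ℚ-ring

mainTheorem20 : (n : ℕ) →
    sumFrom1 n (λ k → signQ (k ∸ 1) * invℕ (k ℕ.* k) * ℕtoℚ (n C k)
                        * (H (n ∸ k) * H (n ∸ k) + H^ 2 (n ∸ k)))
      ≡ ½ * ((H n * H n + H^ 2 n) * (H n * H n + H^ 2 n))
        - ℕtoℚ 2 * sumBelow n (λ k → signQ k * ((H n - H k) * (H n - H k))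
                                      * invℕ (suc k ℕ.* (n ∸ k) ℕ.* (n C k)))
mainTheorem20 n = begin
    L                                             ≡⟨ 2*[½*a]≡a L ⟨
    ℕtoℚ 2 * (½ * L)                              ≡⟨ cong (ℕtoℚ 2 *_) ([x²y²]-binomialConv-β n) ⟨
    ℕtoℚ 2 * [x²y²] (Left.binomialConv Left.β n)  ≡⟨ cong (ℕtoℚ 2 *_) ([x²y²]-cong (binomialConv-β≈rhs n)) ⟩
    ℕtoℚ 2 * [x²y²] (Right.rhs n)                 ≡⟨ cong (ℕtoℚ 2 *_) ([x²y²]-rhs n) ⟩
    ℕtoℚ 2 * (A * ½ * (A * ½) - S)                ≡⟨ expand A S ⟩
    ½ * (A * A) - ℕtoℚ 2 * S                      ∎
  where
  open ≡-Reasoning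
  L A S : ℚ
  L = sumFrom1 n (λ k → signQ (k ∸ 1) * invℕ (k ℕ.* k) * ℕtoℚ (n C k) * (H (n ∸ k) * H (n ∸ k) + H^ 2 (n ∸ k)))
  A = H n * H n + H^ 2 n
  S = sumBelow n (λ k → signQ k * ((H n - H k) * (H n - H k)) * invℕ (suc k ℕ.* (n ∸ k) ℕ.* (n C k)))
  2*[½*a]≡a : ∀ a → ℕtoℚ 2 * (½ * a) ≡ a
  2*[½*a]≡a = solve-∀ ℚ-ring
  expand : ∀ A S → ℕtoℚ 2 * (A * ½ * (A * ½) - S) ≡ ½ * (A * A) - ℕtoℚ 2 * S
  expand = solve-∀ ℚ-ring
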